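{- Let $\mathbf{s}$ be any composite (finite tuple of positive integers) of weight $w$ and let $p$ be an odd prime. Then $$-S(\mathbf{s}^\ast;p-1)\equiv S(\mathbf{s};p-1)+p\sum_{\mathbf{t}\preceq\mathbf{s}}H(\mathbf{t}\sqcup\{1\};p-1)\pmod{p^2}.$$
   Context: For $\mathbf{s}=(s_1,\dots,s_l)$: $H(\mathbf{s};N)=\sum_{1\le k_1<\dots<k_l\le N}k_1^{ -s_1}\cdots k_l^{ -s_l}$, $S(\mathbf{s};N)=\sum_{1\le k_1\le\dots\le k_l\le N}k_1^{ -s_1}\cdots k_l^{ -s_l}$. The weight is $|\mathbf{s}|=\sum s_i$. For a composite $\mathbf{s}=(i_1,\dots,i_k)$ of weight $w$, let $P(\mathbf{s})=\{i_1,i_1+i_2,\dots,i_1+\dots+i_{k-1}\}\subseteq\{1,\dots,w-1\}$; $P$ is a bijection between composites of weight $w$ and subsets of $\{1,\dots,w-1\}$, and $\mathbf{s}^\ast$ is the composite of weight $w$ with $P(\mathbf{s}^\ast)=\{1,\dots,w-1\}\setminus P(\mathbf{s})$. $\mathbf{t}\preceq\mathbf{s}$ means $\mathbf{t}$ is obtained from $\mathbf{s}$ by combining (adding) some groups of consecutive parts (including $\mathbf{t}=\mathbf{s}$). $\mathbf{t}\sqcup\{1\}$ denotes $\mathbf{t}$ with an entry $1$ appended at the end. Congruences of rationals modulo $p^2$ mean the difference has $p$-adic valuation $\ge2$. -}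

module Defs where

open import Data.Nat as ℕ using (ℕ; zero; suc; _+_; _∸_; _^_)
open import Data.Nat.Properties using (m^n≢0)
open import Data.Nat.ListAction using (sum)
open import Data.Bool using (Bool; true; false; not)
open import Data.List using (List; []; _∷_; _++_; map; concatMap; upTo; foldr; length; [_])
open import Data.Integer as ℤ using (ℤ)
open import Data.Integer.Divisibility using () renaming (_∣_ to _∣ℤ_)
open import Data.Rational as ℚ using (ℚ; _/_; ↥_)

-- A composite is a finite list of natural numbers; positivity of the
-- entries is imposed as a hypothesis in the statement.
Composite : Set
Composite = List ℕ

weight : Composite → ℕ
weight = sum

-- k ^ (-a) as a rational (k ≥ 1; the value at k = 0 is never used)
invPow : ℕ → ℕ → ℚ
invPow zero    a = ℚ.0ℚ
invPow (suc j) a = (ℤ.+ 1 / (suc j ^ a)) {{m^n≢0 (suc j) a}}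

Σℚ : List ℚ → ℚ
Σℚ = foldr ℚ._+_ ℚ.0ℚ

-- the list [a, a+1, ..., b]  (empty if b < a)
interval : ℕ → ℕ → List ℕ
interval a b = map (λ i → a + i) (upTo (suc b ∸ a))

-- Hfrom s m N = Σ_{m < k_1 < ... < k_l ≤ N} k_1^{-s_1} ... k_l^{-s_l}
Hfrom : Composite → ℕ → ℕ → ℚ
Hfrom []      m N = ℚ.1ℚ
Hfrom (a ∷ s) m N = Σℚ (map (λ k → invPow k a ℚ.* Hfrom s k N) (interval (suc m) N))

-- Sfrom s m N = Σ_{m ≤ k_1 ≤ ... ≤ k_l ≤ N} k_1^{-s_1} ... k_l^{-s_l}
Sfrom : Composite → ℕ → ℕ → ℚ
Sfrom []      m N = ℚ.1ℚ
Sfrom (a ∷ s) m N = Σℚ (map (λ k → invPow k a ℚ.* Sfrom s k N) (interval m N))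

H : Composite → ℕ → ℚ
H s N = Hfrom s 0 N

S : Composite → ℕ → ℚ
S s N = Sfrom s 1 N

-- Binary encoding: a list of booleans of length w-1 whose j-th entry
-- (j = 1..w-1) is true iff j ∈ P(s) = {i_1, i_1+i_2, ..., i_1+...+i_{k-1}}.
-- A part of size a contributes a-1 'false' positions, and a 'true'
-- separator between consecutive parts.
replicateFalse : ℕ → List Bool
replicateFalse zero    = []
replicateFalse (suc n) = false ∷ replicateFalse n

P : Composite → List Bool
P []          = []
P (a ∷ [])    = replicateFalse (a ∸ 1)
P (a ∷ b ∷ s) = replicateFalse (a ∸ 1) ++ (true ∷ P (b ∷ s))

-- Inverse of P: from the indicator list of a subset of {1,...,w-1}
-- (given as a list of length w-1) to the composite of weight w.
-- 'current' is the size of the part being built.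
fromSubsetAux : ℕ → List Bool → Composite
fromSubsetAux cur []          = [ cur ]
fromSubsetAux cur (true ∷ bs) = cur ∷ fromSubsetAux 1 bs
fromSubsetAux cur (false ∷ bs) = fromSubsetAux (suc cur) bs

fromSubset : ℕ → List Bool → Composite
fromSubset zero    bs = []
fromSubset (suc w) bs = fromSubsetAux 1 bs

dual : Composite → Composite
dual s = fromSubset (weight s) (map not (P s))

-- all compositions obtained from s by adding some groups of consecutive
-- parts (including s itself), listed with multiplicity one per choice of
-- merged gaps (distinct choices give distinct t for positive parts).
coarsenings : Composite → List Composite
coarsenings []          = [ [] ]
coarsenings (a ∷ [])    = [ a ∷ [] ]
coarsenings (a ∷ b ∷ s) =
  concatMap (λ t → (a ∷ t) ∷ mergeHead t) (coarsenings (b ∷ s))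
  where
  mergeHead : Composite → List Composite
  mergeHead []      = []
  mergeHead (c ∷ t) = [ (a + c) ∷ t ]

append1 : Composite → Composite
append1 t = t ++ [ 1 ]

-- Congruence of rationals modulo n: n divides the reduced numerator of
-- x - y.  For n = p², with p prime, this is exactly v_p(x - y) ≥ 2
-- (the reduced denominator is then coprime to p).
_≡_[modℚ_] : ℚ → ℚ → ℕ → Set
x ≡ y [modℚ n ] = (ℤ.+ n) ∣ℤ (↥ (x ℚ.- y))

-- Write p = N + 1 and let φ k be the part of S(s*; k) whose largest summation index is k,
-- so that S(s*; N) = ∑_{k ≤ N} φ k.  Hoffman's duality S(s; n) = -∑_{k ≤ n} (-1)^k (n choose k) φ k
-- follows by induction on the last part of s from two binomial-transform identities.
-- Since a coarsening of (a, b, …) either keeps the part a or merges it into the next one,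
-- ∑_{t ⪯ s} H(t ⊔ {1}; N) = ∑_{j ≤ N} S(s; j - 1) / j = -∑_k φ k E(N, k),
-- where E(N, k) = H_N + ∑_{i ≤ k} (-1)^i (N choose i) / i.  So the difference of the two sides is
-- ∑_k φ k ((-1)^k (p-1 choose k) - 1 + p E(p-1, k)), and each bracket is p² times a p-integral
-- number: (-1)^k (p-1 choose k) = 1 - p H_k + p² (…), and H_{p-1} = p · ½ ∑_j 1 / (j (p - j)).
-- As φ k is p-integral for k < p, p² divides the numerator of the difference.

module Submission where

open import Defs
open import Data.Nat using (ℕ; _≤_; _∸_; _^_)
open import Relation.Binary.PropositionalEquality using (_≢_)
open import Data.Nat.Primality using (Prime)
open import Data.List using (List; []; map)
open import Data.List.Relation.Unary.All using (All; []; _∷_)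
open import Data.Rational as ℚ using (ℚ)
open import Data.Integer as ℤ using (ℤ)

open import Data.Nat as ℕ using (zero; suc; z≤n; s≤s; _<_; NonZero)
import Data.Nat.Properties as ℕP
import Data.Integer.Properties as ℤP
open import Data.Rational using (_+_; _*_; -_; _-_; 0ℚ; 1ℚ; ½; _/_; ↥_; ↧ₙ_; toℚᵘ)
import Data.Rational.Properties as ℚP
import Data.Rational.Unnormalised as ℚᵘ
import Data.Rational.Unnormalised.Properties as ℚᵘP
open import Data.List using (_∷_; _++_; _∷ʳ_; upTo; applyUpTo; concatMap; reverse)
open import Data.Nat.ListAction.Properties using (sum-++)
import Data.List.Properties as List
open import Data.List.Membership.Propositional using (_∈_)
open import Data.List.Membership.Propositional.Properties using (∈-map⁻; ∈-upTo⁻)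
import Data.List.Relation.Unary.All as All
import Data.List.Relation.Unary.All.Properties as AllP
open import Data.Bool using (true; false; not)
open import Data.Maybe using (Maybe; just; nothing)
open import Level using (0ℓ)
open import Data.Product using (Σ; _×_; _,_; proj₁)
open import Function using (_∘_)
open import Data.Sum using (inj₁; inj₂; [_,_]′)
open import Data.Empty using (⊥-elim)
open import Data.Nat.Divisibility using (_∣_; divides; quotient; ∣1⇒≡1; ∣⇒≤)
open import Data.Integer.Divisibility using () renaming (_∣_ to _∣ℤ_)
open import Data.Nat.Primality using (euclidsLemma; prime⇒nonZero; ¬prime[0]; ¬prime[1])
open import Relation.Nullary using (¬_; yes; no)
open import Relation.Binary.PropositionalEquality
  using (_≡_; refl; sym; trans; cong; cong₂; subst; module ≡-Reasoning)
open import Tactic.RingSolver using (solve-∀)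
import Data.Nat.Tactic.RingSolver as ℕSolver
import Data.Integer.Tactic.RingSolver as ℤSolver
open import Tactic.RingSolver.Core.AlmostCommutativeRing
  using (AlmostCommutativeRing; fromCommutativeRing)

-- Rational arithmetic

ℚ-ring : AlmostCommutativeRing 0ℓ 0ℓ
ℚ-ring = fromCommutativeRing ℚP.+-*-commutativeRing isZero
  where
  isZero : ∀ x → Maybe (0ℚ ≡ x)
  isZero x with 0ℚ ℚP.≟ x
  ... | yes 0≡x = just 0≡x
  ... | no _    = nothing

swap-factors : ∀ x y z → x * (y * z) ≡ y * (x * z)
swap-factors = solve-∀ ℚ-ring

fromℤ : ℤ → ℚ
fromℤ z = z / 1

fromℕ : ℕ → ℚ
fromℕ n = fromℤ (ℤ.+ n)

toℚᵘ-fromℤ : ∀ z → toℚᵘ (fromℤ z) ℚᵘ.≃ ℚᵘ.mkℚᵘ z 0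
toℚᵘ-fromℤ z = ℚP.toℚᵘ-fromℚᵘ (ℚᵘ.mkℚᵘ z 0)

fromℤ-+ : ∀ a b → fromℤ (a ℤ.+ b) ≡ fromℤ a + fromℤ b
fromℤ-+ a b = ℚP.toℚᵘ-injective (ℚᵘP.≃-trans (toℚᵘ-fromℤ (a ℤ.+ b)) (ℚᵘP.≃-trans (ℚᵘ.*≡* (ℤ-identity a b))
  (ℚᵘP.≃-sym (ℚᵘP.≃-trans (ℚP.toℚᵘ-homo-+ (fromℤ a) (fromℤ b)) (ℚᵘP.+-cong (toℚᵘ-fromℤ a) (toℚᵘ-fromℤ b))))))
  where
  ℤ-identity : ∀ a b → (a ℤ.+ b) ℤ.* ℤ.+ 1 ≡ (a ℤ.* ℤ.+ 1 ℤ.+ b ℤ.* ℤ.+ 1) ℤ.* ℤ.+ 1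
  ℤ-identity = ℤSolver.solve-∀

fromℤ-* : ∀ a b → fromℤ (a ℤ.* b) ≡ fromℤ a * fromℤ b
fromℤ-* a b = ℚP.toℚᵘ-injective (ℚᵘP.≃-trans (toℚᵘ-fromℤ (a ℤ.* b))
  (ℚᵘP.≃-sym (ℚᵘP.≃-trans (ℚP.toℚᵘ-homo-* (fromℤ a) (fromℤ b)) (ℚᵘP.*-cong (toℚᵘ-fromℤ a) (toℚᵘ-fromℤ b)))))

fromℤ-neg : ∀ a → fromℤ (ℤ.- a) ≡ - fromℤ a
fromℤ-neg a = ℚP.toℚᵘ-injective (ℚᵘP.≃-trans (toℚᵘ-fromℤ (ℤ.- a))
  (ℚᵘP.≃-sym (ℚᵘP.≃-trans (ℚP.toℚᵘ-homo‿- (fromℤ a)) (ℚᵘP.-‿cong (toℚᵘ-fromℤ a)))))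

fromℕ-+ : ∀ m n → fromℕ (m ℕ.+ n) ≡ fromℕ m + fromℕ n
fromℕ-+ m n = fromℤ-+ (ℤ.+ m) (ℤ.+ n)

fromℕ-suc : ∀ n → fromℕ (suc n) ≡ 1ℚ + fromℕ n
fromℕ-suc = fromℕ-+ 1

fromℕ-* : ∀ m n → fromℕ (m ℕ.* n) ≡ fromℕ m * fromℕ n
fromℕ-* m n = trans (cong fromℤ (ℤP.pos-* m n)) (fromℤ-* (ℤ.+ m) (ℤ.+ n))

1/ℕ-inverse : ∀ n .{{_ : NonZero n}} → ((ℤ.+ 1) / n) * fromℕ n ≡ 1ℚ
1/ℕ-inverse n@(suc m) = ℚP.toℚᵘ-injective (ℚᵘP.≃-trans (ℚP.toℚᵘ-homo-* ((ℤ.+ 1) / n) (fromℕ n))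
  (ℚᵘP.≃-trans (ℚᵘP.*-cong (ℚP.toℚᵘ-fromℚᵘ (ℚᵘ.mkℚᵘ (ℤ.+ 1) m)) (toℚᵘ-fromℤ (ℤ.+ n)))
    (ℚᵘ.*≡* (cong (λ x → ℤ.+ suc x) (ℕ-identity m)))))
  where
  ℕ-identity : ∀ m → (m ℕ.+ 0 ℕ.* suc m) ℕ.* 1 ≡ m ℕ.* 1 ℕ.+ 0 ℕ.* suc (m ℕ.* 1)
  ℕ-identity = ℕSolver.solve-∀

inverse-unique : ∀ a b c → a * c ≡ 1ℚ → b * c ≡ 1ℚ → a ≡ b
inverse-unique a b c ac≡1 bc≡1 = begin
  a            ≡⟨ ℚP.*-identityʳ a ⟨
  a * 1ℚ       ≡⟨ cong (a *_) bc≡1 ⟨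
  a * (b * c)  ≡⟨ swap-factors a b c ⟩
  b * (a * c)  ≡⟨ cong (b *_) ac≡1 ⟩
  b * 1ℚ       ≡⟨ ℚP.*-identityʳ b ⟩
  b            ∎
  where open ≡-Reasoning

invPow-inverse : ∀ j a → invPow (suc j) a * fromℕ (suc j ^ a) ≡ 1ℚ
invPow-inverse j a = 1/ℕ-inverse (suc j ^ a) {{ℕP.m^n≢0 (suc j) a}}

invPow-+ : ∀ k a c → invPow k (a ℕ.+ c) ≡ invPow k a * invPow k c
invPow-+ zero    a c = refl
invPow-+ (suc j) a c = inverse-unique _ _ (fromℕ (suc j ^ (a ℕ.+ c))) (invPow-inverse j (a ℕ.+ c)) (begin
  (x * y) * fromℕ (suc j ^ (a ℕ.+ c))
    ≡⟨ cong (λ n → (x * y) * fromℕ n) (ℕP.^-distribˡ-+-* (suc j) a c) ⟩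
  (x * y) * fromℕ (suc j ^ a ℕ.* suc j ^ c)
    ≡⟨ cong ((x * y) *_) (fromℕ-* (suc j ^ a) (suc j ^ c)) ⟩
  (x * y) * (fromℕ (suc j ^ a) * fromℕ (suc j ^ c))
    ≡⟨ interchange x y _ _ ⟩
  (x * fromℕ (suc j ^ a)) * (y * fromℕ (suc j ^ c))
    ≡⟨ cong₂ _*_ (invPow-inverse j a) (invPow-inverse j c) ⟩
  1ℚ ∎)
  where
  open ≡-Reasoning
  x : ℚ
  x = invPow (suc j) a
  y : ℚ
  y = invPow (suc j) c
  interchange : ∀ x y z w → (x * y) * (z * w) ≡ (x * z) * (y * w)
  interchange = solve-∀ ℚ-ring

inv : ℕ → ℚ
inv k = invPow k 1

invPow-suc : ∀ k a → invPow k (suc a) ≡ inv k * invPow k a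
invPow-suc k a = invPow-+ k 1 a

inv-inverse : ∀ j → inv (suc j) * fromℕ (suc j) ≡ 1ℚ
inv-inverse j = subst (λ n → inv (suc j) * fromℕ n ≡ 1ℚ) (ℕP.*-identityʳ (suc j)) (invPow-inverse j 1)

cancel-inverse : ∀ x y z → x * y ≡ 1ℚ → x * (y * z) ≡ z
cancel-inverse x y z xy≡1 = trans (sym (ℚP.*-assoc x y z)) (trans (cong (_* z) xy≡1) (ℚP.*-identityˡ z))

-- Finite sums

Σℚ-++ : ∀ xs ys → Σℚ (xs ++ ys) ≡ Σℚ xs + Σℚ ys
Σℚ-++ []       ys = sym (ℚP.+-identityˡ (Σℚ ys))
Σℚ-++ (x ∷ xs) ys = trans (cong (x +_) (Σℚ-++ xs ys)) (sym (ℚP.+-assoc x (Σℚ xs) (Σℚ ys)))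

Σℚ-map-0 : ∀ {A : Set} (xs : List A) → Σℚ (map (λ _ → 0ℚ) xs) ≡ 0ℚ
Σℚ-map-0 []       = refl
Σℚ-map-0 (x ∷ xs) = trans (ℚP.+-identityˡ _) (Σℚ-map-0 xs)

Σℚ-map-+ : ∀ {A : Set} (f g : A → ℚ) xs → Σℚ (map (λ x → f x + g x) xs) ≡ Σℚ (map f xs) + Σℚ (map g xs)
Σℚ-map-+ f g []       = refl
Σℚ-map-+ f g (x ∷ xs) = trans (cong (f x + g x +_) (Σℚ-map-+ f g xs)) (interchange (f x) (g x) _ _)
  where
  interchange : ∀ a b c d → (a + b) + (c + d) ≡ (a + c) + (b + d)
  interchange = solve-∀ ℚ-ring

Σℚ-map-*ˡ : ∀ {A : Set} c (f : A → ℚ) xs → Σℚ (map (λ x → c * f x) xs) ≡ c * Σℚ (map f xs)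
Σℚ-map-*ˡ c f []       = sym (ℚP.*-zeroʳ c)
Σℚ-map-*ˡ c f (x ∷ xs) = trans (cong (c * f x +_) (Σℚ-map-*ˡ c f xs)) (sym (ℚP.*-distribˡ-+ c (f x) _))

Σℚ-map-neg : ∀ {A : Set} (f : A → ℚ) xs → Σℚ (map (λ x → - f x) xs) ≡ - Σℚ (map f xs)
Σℚ-map-neg f []       = refl
Σℚ-map-neg f (x ∷ xs) = trans (cong (- f x +_) (Σℚ-map-neg f xs)) (sym (ℚP.neg-distrib-+ (f x) _))

Σℚ-map-comm : ∀ {A B : Set} (F : A → B → ℚ) xs ys →
  Σℚ (map (λ x → Σℚ (map (F x) ys)) xs) ≡ Σℚ (map (λ y → Σℚ (map (λ x → F x y) xs)) ys)
Σℚ-map-comm F []       ys = sym (Σℚ-map-0 ys)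
Σℚ-map-comm F (x ∷ xs) ys =
  trans (cong (Σℚ (map (F x) ys) +_) (Σℚ-map-comm F xs ys)) (sym (Σℚ-map-+ (F x) _ ys))

Σℚ-map-concatMap : ∀ {A B : Set} (f : B → ℚ) (g : A → List B) xs →
  Σℚ (map f (concatMap g xs)) ≡ Σℚ (map (λ x → Σℚ (map f (g x))) xs)
Σℚ-map-concatMap f g []       = refl
Σℚ-map-concatMap f g (x ∷ xs) = begin
  Σℚ (map f (g x ++ concatMap g xs))              ≡⟨ cong Σℚ (List.map-++ f (g x) _) ⟩
  Σℚ (map f (g x) ++ map f (concatMap g xs))      ≡⟨ Σℚ-++ (map f (g x)) _ ⟩
  Σℚ (map f (g x)) + Σℚ (map f (concatMap g xs))  ≡⟨ cong (Σℚ (map f (g x)) +_) (Σℚ-map-concatMap f g xs) ⟩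
  Σℚ (map f (g x)) + Σℚ (map (λ y → Σℚ (map f (g y))) xs) ∎
  where open ≡-Reasoning

interval-empty : ∀ {a b} → b < a → interval a b ≡ []
interval-empty {a} b<a = cong (λ n → map (a ℕ.+_) (upTo n)) (ℕP.m≤n⇒m∸n≡0 b<a)

interval-∷ : ∀ {a b} → a ≤ b → interval a b ≡ a ∷ interval (suc a) b
interval-∷ {a} {b} a≤b = begin
  map (a ℕ.+_) (upTo (suc b ∸ a))                ≡⟨ cong (λ n → map (a ℕ.+_) (upTo n)) (ℕP.+-∸-assoc 1 a≤b) ⟩
  a ℕ.+ 0 ∷ map (a ℕ.+_) (applyUpTo suc (b ∸ a))
    ≡⟨ cong₂ _∷_ (ℕP.+-identityʳ a) (cong (map (a ℕ.+_)) (sym (List.map-upTo suc (b ∸ a)))) ⟩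
  a ∷ map (a ℕ.+_) (map suc (upTo (b ∸ a)))      ≡⟨ cong (a ∷_) (sym (List.map-∘ (upTo (b ∸ a)))) ⟩
  a ∷ map ((a ℕ.+_) ∘ suc) (upTo (b ∸ a))        ≡⟨ cong (a ∷_) (List.map-cong (ℕP.+-suc a) (upTo (b ∸ a))) ⟩
  a ∷ interval (suc a) b                         ∎
  where open ≡-Reasoning

interval-∷ʳ : ∀ {a b} → a ≤ suc b → interval a (suc b) ≡ interval a b ∷ʳ suc b
interval-∷ʳ {a} {b} a≤ = begin
  map (a ℕ.+_) (upTo (suc (suc b) ∸ a))  ≡⟨ cong (λ n → map (a ℕ.+_) (upTo n)) (ℕP.+-∸-assoc 1 a≤) ⟩
  map (a ℕ.+_) (upTo (suc n))            ≡⟨ cong (map (a ℕ.+_)) (sym (List.upTo-∷ʳ n)) ⟩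
  map (a ℕ.+_) (upTo n ∷ʳ n)             ≡⟨ List.map-++ (a ℕ.+_) (upTo n) _ ⟩
  interval a b ∷ʳ (a ℕ.+ n)              ≡⟨ cong (interval a b ∷ʳ_) (ℕP.m+[n∸m]≡n a≤) ⟩
  interval a b ∷ʳ suc b                  ∎
  where
  open ≡-Reasoning
  n : ℕ
  n = suc b ∸ a

∈-interval⁻ : ∀ {a b k} → k ∈ interval a b → a ≤ k × k ≤ b
∈-interval⁻ {a} {b} k∈ with ∈-map⁻ (a ℕ.+_) k∈
... | i , i∈ , refl = ℕP.m≤m+n a i , ℕ.s≤s⁻¹ (subst (_≤ suc b) 1+i+a≡a+1+i (ℕP.m≤o∸n⇒m+n≤o (suc i) a≤1+b i<))
  where
  1+i+a≡a+1+i : suc i ℕ.+ a ≡ suc (a ℕ.+ i)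
  1+i+a≡a+1+i = trans (ℕP.+-comm (suc i) a) (ℕP.+-suc a i)
  i< : i < suc b ∸ a
  i< = ∈-upTo⁻ i∈
  a≤1+b : a ≤ suc b
  a≤1+b = ℕP.<⇒≤ (ℕP.m∸n≢0⇒n<m (λ eq → ℕP.n≮0 (subst (i <_) eq i<)))

-- Opaque, so that unification never unfolds a sum while solving for its bounds.
opaque
  ∑ : ℕ → ℕ → (ℕ → ℚ) → ℚ
  ∑ a b f = Σℚ (map f (interval a b))

  ∑-def : ∀ a b f → ∑ a b f ≡ Σℚ (map f (interval a b))
  ∑-def a b f = refl

  ∑-empty : ∀ {a b} f → b < a → ∑ a b f ≡ 0ℚ
  ∑-empty f b<a = cong (Σℚ ∘ map f) (interval-empty b<a)

  ∑-∷ : ∀ {a b} f → a ≤ b → ∑ a b f ≡ f a + ∑ (suc a) b f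
  ∑-∷ f a≤b = cong (Σℚ ∘ map f) (interval-∷ a≤b)

  ∑-∷ʳ : ∀ {a b} f → a ≤ suc b → ∑ a (suc b) f ≡ ∑ a b f + f (suc b)
  ∑-∷ʳ {a} {b} f a≤ = begin
    Σℚ (map f (interval a (suc b)))                 ≡⟨ cong (Σℚ ∘ map f) (interval-∷ʳ a≤) ⟩
    Σℚ (map f (interval a b ∷ʳ suc b))              ≡⟨ cong Σℚ (List.map-++ f (interval a b) _) ⟩
    Σℚ (map f (interval a b) ∷ʳ f (suc b))          ≡⟨ Σℚ-++ (map f (interval a b)) _ ⟩
    ∑ a b f + (f (suc b) + 0ℚ)                      ≡⟨ cong (∑ a b f +_) (ℚP.+-identityʳ (f (suc b))) ⟩
    ∑ a b f + f (suc b)                             ∎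
    where open ≡-Reasoning

  ∑-∷ʳ-0 : ∀ a b f → f (suc b) ≡ 0ℚ → ∑ a (suc b) f ≡ ∑ a b f
  ∑-∷ʳ-0 a b f f≡0 with a ℕ.≤? suc b
  ... | yes a≤ = trans (∑-∷ʳ f a≤) (trans (cong (∑ a b f +_) f≡0) (ℚP.+-identityʳ _))
  ... | no a≰ = trans (∑-empty f (ℕP.≰⇒> a≰)) (sym (∑-empty f (ℕP.<-trans (ℕP.n<1+n b) (ℕP.≰⇒> a≰))))

  ∑-cong : ∀ {a b} {f g : ℕ → ℚ} → (∀ k → a ≤ k → k ≤ b → f k ≡ g k) → ∑ a b f ≡ ∑ a b g
  ∑-cong f≡g = cong Σℚ (List.map-cong-local (All.tabulate λ k∈ → let a≤k , k≤b = ∈-interval⁻ k∈ in f≡g _ a≤k k≤b))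

  ∑-+ : ∀ a b f g → ∑[ k ∈ a ⋯ b ] (f k + g k) ≡ ∑ a b f + ∑ a b g
  ∑-+ a b f g = Σℚ-map-+ f g (interval a b)

  ∑-*ˡ : ∀ a b c f → ∑[ k ∈ a ⋯ b ] (c * f k) ≡ c * ∑ a b f
  ∑-*ˡ a b c f = Σℚ-map-*ˡ c f (interval a b)

  ∑-neg : ∀ a b f → ∑[ k ∈ a ⋯ b ] (- f k) ≡ - ∑ a b f
  ∑-neg a b f = Σℚ-map-neg f (interval a b)

  ∑-Σℚ-comm : ∀ {A : Set} a b (F : A → ℕ → ℚ) xs →
    Σℚ (map (λ x → ∑ a b (F x)) xs) ≡ ∑[ k ∈ a ⋯ b ] Σℚ (map (λ x → F x k) xs)
  ∑-Σℚ-comm a b F xs = Σℚ-map-comm F xs (interval a b)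

  ∑-shift : ∀ a b f → ∑ (suc a) (suc b) f ≡ ∑ a b (f ∘ suc)
  ∑-shift a b f = cong Σℚ (trans (sym (List.map-∘ (upTo (suc b ∸ a)))) (List.map-∘ (upTo (suc b ∸ a))))

syntax ∑ a b (λ k → e) = ∑[ k ∈ a ⋯ b ] e

∑-singleton : ∀ a f → ∑ a a f ≡ f a
∑-singleton a f = trans (∑-∷ f ℕP.≤-refl) (trans (cong (f a +_) (∑-empty f ℕP.≤-refl)) (ℚP.+-identityʳ (f a)))

∑-swap-≤ : ∀ a n (F : ℕ → ℕ → ℚ) →
  ∑[ k ∈ a ⋯ n ] ∑[ j ∈ k ⋯ n ] F k j ≡ ∑[ j ∈ a ⋯ n ] ∑[ k ∈ a ⋯ j ] F k j
∑-swap-≤ a n F with a ℕ.≤? n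
∑-swap-≤ a n F | no a≰n = trans (∑-empty _ (ℕP.≰⇒> a≰n)) (sym (∑-empty _ (ℕP.≰⇒> a≰n)))
∑-swap-≤ .0 zero F | yes z≤n = begin
  ∑[ k ∈ 0 ⋯ 0 ] ∑[ j ∈ k ⋯ 0 ] F k j  ≡⟨ ∑-singleton 0 _ ⟩
  ∑[ j ∈ 0 ⋯ 0 ] F 0 j                ≡⟨ ∑-singleton 0 _ ⟩
  F 0 0                               ≡⟨ ∑-singleton 0 _ ⟨
  ∑[ k ∈ 0 ⋯ 0 ] F k 0                ≡⟨ ∑-singleton 0 _ ⟨
  ∑[ j ∈ 0 ⋯ 0 ] ∑[ k ∈ 0 ⋯ j ] F k j  ∎
  where open ≡-Reasoning
∑-swap-≤ a (suc n) F | yes a≤ = begin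
  ∑[ k ∈ a ⋯ suc n ] ∑[ j ∈ k ⋯ suc n ] F k j
    ≡⟨ ∑-cong (λ k _ k≤ → ∑-∷ʳ (F k) k≤) ⟩
  ∑[ k ∈ a ⋯ suc n ] (∑[ j ∈ k ⋯ n ] F k j + F k (suc n))
    ≡⟨ ∑-+ a (suc n) _ _ ⟩
  ∑[ k ∈ a ⋯ suc n ] ∑[ j ∈ k ⋯ n ] F k j + ∑[ k ∈ a ⋯ suc n ] F k (suc n)
    ≡⟨ cong (_+ last) (∑-∷ʳ-0 a n _ (∑-empty _ (ℕP.n<1+n n))) ⟩
  ∑[ k ∈ a ⋯ n ] ∑[ j ∈ k ⋯ n ] F k j + last
    ≡⟨ cong (_+ last) (∑-swap-≤ a n F) ⟩
  ∑[ j ∈ a ⋯ n ] ∑[ k ∈ a ⋯ j ] F k j + last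
    ≡⟨ ∑-∷ʳ _ a≤ ⟨
  ∑[ j ∈ a ⋯ suc n ] ∑[ k ∈ a ⋯ j ] F k j ∎
  where
  open ≡-Reasoning
  last : ℚ
  last = ∑[ k ∈ a ⋯ suc n ] F k (suc n)

∑-swap-< : ∀ a n (F : ℕ → ℕ → ℚ) →
  ∑[ k ∈ suc a ⋯ n ] ∑[ j ∈ suc k ⋯ n ] F k j ≡ ∑[ j ∈ suc a ⋯ n ] ∑[ k ∈ suc a ⋯ j ∸ 1 ] F k j
∑-swap-< a zero F = trans (∑-empty _ (s≤s z≤n)) (sym (∑-empty _ (s≤s z≤n)))
∑-swap-< a (suc n) F with suc a ℕ.≤? suc n
... | no a≰n = trans (∑-empty _ (ℕP.≰⇒> a≰n)) (sym (∑-empty _ (ℕP.≰⇒> a≰n)))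
... | yes a≤ = begin
  ∑[ k ∈ suc a ⋯ suc n ] ∑[ j ∈ suc k ⋯ suc n ] F k j
    ≡⟨ ∑-∷ʳ-0 (suc a) n _ (∑-empty _ (ℕP.n<1+n (suc n))) ⟩
  ∑[ k ∈ suc a ⋯ n ] ∑[ j ∈ suc k ⋯ suc n ] F k j
    ≡⟨ ∑-cong (λ k _ k≤ → ∑-∷ʳ (F k) (s≤s k≤)) ⟩
  ∑[ k ∈ suc a ⋯ n ] (∑[ j ∈ suc k ⋯ n ] F k j + F k (suc n))
    ≡⟨ ∑-+ (suc a) n _ _ ⟩
  ∑[ k ∈ suc a ⋯ n ] ∑[ j ∈ suc k ⋯ n ] F k j + ∑[ k ∈ suc a ⋯ n ] F k (suc n)
    ≡⟨ cong (_+ ∑[ k ∈ suc a ⋯ n ] F k (suc n)) (∑-swap-< a n F) ⟩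
  ∑[ j ∈ suc a ⋯ n ] ∑[ k ∈ suc a ⋯ j ∸ 1 ] F k j + ∑[ k ∈ suc a ⋯ n ] F k (suc n)
    ≡⟨ ∑-∷ʳ _ a≤ ⟨
  ∑[ j ∈ suc a ⋯ suc n ] ∑[ k ∈ suc a ⋯ j ∸ 1 ] F k j ∎
  where open ≡-Reasoning

∑-reflect : ∀ n f → ∑ 1 n f ≡ ∑[ j ∈ 1 ⋯ n ] f (suc n ∸ j)
∑-reflect zero    f = trans (∑-empty f (s≤s z≤n)) (sym (∑-empty _ (s≤s z≤n)))
∑-reflect (suc n) f = begin
  ∑ 1 (suc n) f                              ≡⟨ ∑-∷ʳ f (s≤s z≤n) ⟩
  ∑ 1 n f + f (suc n)                        ≡⟨ ℚP.+-comm (∑ 1 n f) (f (suc n)) ⟩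
  f (suc n) + ∑ 1 n f                        ≡⟨ cong (f (suc n) +_) (∑-reflect n f) ⟩
  f (suc n) + ∑[ j ∈ 1 ⋯ n ] f (suc n ∸ j)   ≡⟨ cong (f (suc n) +_) (∑-shift 1 n (λ j → f (suc (suc n) ∸ j))) ⟨
  f (suc n) + ∑[ j ∈ 2 ⋯ suc n ] f (suc (suc n) ∸ j) ≡⟨ ∑-∷ _ (s≤s z≤n) ⟨
  ∑[ j ∈ 1 ⋯ suc n ] f (suc (suc n) ∸ j)     ∎
  where open ≡-Reasoning

-- Signed binomial coefficients and binomial transforms

-- C± n k = (-1)^k (n choose k), generated by Pascal's rule.
C± : ℕ → ℕ → ℚ
C± n       zero    = 1ℚ
C± zero    (suc k) = 0ℚ
C± (suc n) (suc k) = C± n (suc k) - C± n k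

C±-vanish : ∀ n k → n < k → C± n k ≡ 0ℚ
C±-vanish zero    (suc k) _         = refl
C±-vanish (suc n) (suc k) (s≤s n<k) =
  cong₂ _-_ (C±-vanish n (suc k) (ℕP.m<n⇒m<1+n n<k)) (C±-vanish n k n<k)

C±-integral : ∀ n k → Σ ℤ λ z → C± n k ≡ fromℤ z
C±-integral n       zero    = ℤ.+ 1 , refl
C±-integral zero    (suc k) = ℤ.+ 0 , refl
C±-integral (suc n) (suc k) with C±-integral n (suc k) | C±-integral n k
... | z₁ , e₁ | z₂ , e₂ = z₁ ℤ.- z₂ ,
  trans (cong₂ _-_ e₁ e₂) (sym (trans (fromℤ-+ z₁ (ℤ.- z₂)) (cong (fromℤ z₁ +_) (fromℤ-neg z₂))))

C±-partial-sum : ∀ n k → 1ℚ + ∑ 1 k (C± (suc n)) ≡ C± n k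
C±-partial-sum n zero    = trans (cong (1ℚ +_) (∑-empty _ (s≤s z≤n))) (ℚP.+-identityʳ 1ℚ)
C±-partial-sum n (suc k) = begin
  1ℚ + ∑ 1 (suc k) (C± (suc n))                          ≡⟨ cong (1ℚ +_) (∑-∷ʳ _ (s≤s z≤n)) ⟩
  1ℚ + (∑ 1 k (C± (suc n)) + (C± n (suc k) - C± n k))    ≡⟨ ℚP.+-assoc 1ℚ (∑ 1 k (C± (suc n))) _ ⟨
  (1ℚ + ∑ 1 k (C± (suc n))) + (C± n (suc k) - C± n k)    ≡⟨ cong (_+ (C± n (suc k) - C± n k)) (C±-partial-sum n k) ⟩
  C± n k + (C± n (suc k) - C± n k)                       ≡⟨ telescope (C± n k) (C± n (suc k)) ⟩
  C± n (suc k)                                           ∎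
  where
  open ≡-Reasoning
  telescope : ∀ a b → a + (b - a) ≡ b
  telescope = solve-∀ ℚ-ring

C±-row-sum : ∀ m → ∑ 1 (suc m) (C± (suc m)) ≡ - 1ℚ
C±-row-sum m = begin
  ∑ 1 (suc m) (C± (suc m))                 ≡⟨ shuffle (∑ 1 (suc m) (C± (suc m))) ⟩
  (1ℚ + ∑ 1 (suc m) (C± (suc m))) - 1ℚ     ≡⟨ cong (_- 1ℚ) (C±-partial-sum m (suc m)) ⟩
  C± m (suc m) - 1ℚ                        ≡⟨ cong (_- 1ℚ) (C±-vanish m (suc m) (ℕP.n<1+n m)) ⟩
  - 1ℚ                                     ∎
  where
  open ≡-Reasoning
  shuffle : ∀ a → a ≡ (1ℚ + a) - 1ℚ
  shuffle = solve-∀ ℚ-ring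

C±-absorption : ∀ m k → fromℕ (suc k) * C± (suc m) (suc k) ≡ - (fromℕ (suc m) * C± m k)
C±-absorption zero    zero    = refl
C±-absorption zero    (suc k) = ℚP.*-zeroʳ (fromℕ (suc (suc k)))
C±-absorption (suc m) zero    = begin
  fromℕ 1 * (C± (suc m) 1 - 1ℚ)        ≡⟨ distrib (fromℕ 1) (C± (suc m) 1) ⟩
  fromℕ 1 * C± (suc m) 1 - 1ℚ          ≡⟨ cong (_- 1ℚ) (C±-absorption m zero) ⟩
  - (fromℕ (suc m) * 1ℚ) - 1ℚ          ≡⟨ collect (fromℕ (suc m)) ⟩
  - ((1ℚ + fromℕ (suc m)) * 1ℚ)        ≡⟨ cong (λ x → - (x * 1ℚ)) (fromℕ-suc (suc m)) ⟨
  - (fromℕ (suc (suc m)) * 1ℚ)         ∎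
  where
  open ≡-Reasoning
  distrib : ∀ y b → y * (b - 1ℚ) ≡ y * b - y
  distrib = solve-∀ ℚ-ring
  collect : ∀ x → - (x * 1ℚ) - 1ℚ ≡ - ((1ℚ + x) * 1ℚ)
  collect = solve-∀ ℚ-ring
C±-absorption (suc m) (suc k) = begin
  fromℕ (suc (suc k)) * (A - B)                            ≡⟨ cong (_* (A - B)) (fromℕ-suc (suc k)) ⟩
  (1ℚ + fromℕ (suc k)) * (A - B)                           ≡⟨ distrib (fromℕ (suc k)) A B ⟩
  ((1ℚ + fromℕ (suc k)) * A - B) - fromℕ (suc k) * B       ≡⟨ cong (λ x → (x * A - B) - fromℕ (suc k) * B) (fromℕ-suc (suc k)) ⟨
  (fromℕ (suc (suc k)) * A - B) - fromℕ (suc k) * B        ≡⟨ cong₂ (λ x y → (x - B) - y) (C±-absorption m (suc k)) (C±-absorption m k) ⟩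
  (- (fromℕ (suc m) * c) - (c - d)) - - (fromℕ (suc m) * d) ≡⟨ collect (fromℕ (suc m)) c d ⟩
  - ((1ℚ + fromℕ (suc m)) * (c - d))                       ≡⟨ cong (λ x → - (x * (c - d))) (fromℕ-suc (suc m)) ⟨
  - (fromℕ (suc (suc m)) * B)                              ∎
  where
  open ≡-Reasoning
  A : ℚ
  A = C± (suc m) (suc (suc k))
  B : ℚ
  B = C± (suc m) (suc k)
  c : ℚ
  c = C± m (suc k)
  d : ℚ
  d = C± m k
  distrib : ∀ x A B → (1ℚ + x) * (A - B) ≡ ((1ℚ + x) * A - B) - x * B
  distrib = solve-∀ ℚ-ring
  collect : ∀ y c d → (- (y * c) - (c - d)) - - (y * d) ≡ - ((1ℚ + y) * (c - d))
  collect = solve-∀ ℚ-ring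

C±-absorption-inv : ∀ m j → inv (suc j) * C± m j ≡ - (inv (suc m) * C± (suc m) (suc j))
C±-absorption-inv m j = begin
  u * C± m j                                ≡⟨ cong (u *_) (cancel-inverse v (fromℕ (suc m)) (C± m j) (inv-inverse m)) ⟨
  u * (v * (fromℕ (suc m) * C± m j))        ≡⟨ negate u v _ ⟩
  - (u * (v * - (fromℕ (suc m) * C± m j)))  ≡⟨ cong (λ x → - (u * (v * x))) (C±-absorption m j) ⟨
  - (u * (v * (fromℕ (suc j) * B)))         ≡⟨ cong -_ (swap-factors u v _) ⟩
  - (v * (u * (fromℕ (suc j) * B)))         ≡⟨ cong (λ x → - (v * x)) (cancel-inverse u (fromℕ (suc j)) B (inv-inverse j)) ⟩
  - (v * B)                                 ∎
  where
  open ≡-Reasoning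
  u : ℚ
  u = inv (suc j)
  v : ℚ
  v = inv (suc m)
  B : ℚ
  B = C± (suc m) (suc j)
  negate : ∀ u v x → u * (v * x) ≡ - (u * (v * - x))
  negate = solve-∀ ℚ-ring

C±-step : ∀ n k → fromℕ (suc k) * C± n (suc k) ≡ (fromℕ k - fromℕ n) * C± n k
C±-step n k = begin
  fromℕ (suc k) * C± n (suc k)                                         ≡⟨ split (fromℕ (suc k)) (C± n (suc k)) (C± n k) ⟩
  fromℕ (suc k) * (C± n (suc k) - C± n k) + fromℕ (suc k) * C± n k     ≡⟨ cong (_+ fromℕ (suc k) * C± n k) (C±-absorption n k) ⟩
  - (fromℕ (suc n) * C± n k) + fromℕ (suc k) * C± n k                  ≡⟨ cong₂ (λ x y → - (x * C± n k) + y * C± n k) (fromℕ-suc n) (fromℕ-suc k) ⟩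
  - ((1ℚ + fromℕ n) * C± n k) + (1ℚ + fromℕ k) * C± n k                ≡⟨ collect (fromℕ n) (fromℕ k) (C± n k) ⟩
  (fromℕ k - fromℕ n) * C± n k                                         ∎
  where
  open ≡-Reasoning
  split : ∀ x a b → x * a ≡ x * (a - b) + x * b
  split = solve-∀ ℚ-ring
  collect : ∀ x y b → - ((1ℚ + x) * b) + (1ℚ + y) * b ≡ (y - x) * b
  collect = solve-∀ ℚ-ring

C±-ratio : ∀ n k → C± n (suc k) ≡ (1ℚ - fromℕ (suc n) * inv (suc k)) * C± n k
C±-ratio n k = begin
  C± n (suc k)                                           ≡⟨ cancel-inverse v (fromℕ (suc k)) _ (inv-inverse k) ⟨
  v * (fromℕ (suc k) * C± n (suc k))                     ≡⟨ cong (v *_) (C±-step n k) ⟩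
  v * ((fromℕ k - fromℕ n) * C± n k)                     ≡⟨ expand v (fromℕ k) (fromℕ n) (C± n k) ⟩
  (v * (1ℚ + fromℕ k) - (1ℚ + fromℕ n) * v) * C± n k     ≡⟨ cong₂ (λ x y → (v * x - y * v) * C± n k) (fromℕ-suc k) (fromℕ-suc n) ⟨
  (v * fromℕ (suc k) - fromℕ (suc n) * v) * C± n k       ≡⟨ cong (λ x → (x - fromℕ (suc n) * v) * C± n k) (inv-inverse k) ⟩
  (1ℚ - fromℕ (suc n) * v) * C± n k                      ∎
  where
  open ≡-Reasoning
  v : ℚ
  v = inv (suc k)
  expand : ∀ v k n c → v * ((k - n) * c) ≡ (v * (1ℚ + k) - (1ℚ + n) * v) * c
  expand = solve-∀ ℚ-ring

∑-by-parts : ∀ n (f w : ℕ → ℚ) →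
  ∑[ k ∈ 1 ⋯ n ] (f k * ∑ 1 k w) ≡ ∑[ j ∈ 1 ⋯ n ] (w j * (∑ 1 n f - ∑ 1 (j ∸ 1) f))
∑-by-parts zero    f w = trans (∑-empty _ (s≤s z≤n)) (sym (∑-empty _ (s≤s z≤n)))
∑-by-parts (suc n) f w = begin
  ∑[ k ∈ 1 ⋯ suc n ] (f k * ∑ 1 k w)
    ≡⟨ ∑-∷ʳ _ (s≤s z≤n) ⟩
  ∑[ k ∈ 1 ⋯ n ] (f k * ∑ 1 k w) + f (suc n) * ∑ 1 (suc n) w
    ≡⟨ cong₂ _+_ (∑-by-parts n f w) (sym (∑-*ˡ 1 (suc n) (f (suc n)) w)) ⟩
  ∑[ j ∈ 1 ⋯ n ] (w j * (F - ∑ 1 (j ∸ 1) f)) + ∑[ j ∈ 1 ⋯ suc n ] (f (suc n) * w j)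
    ≡⟨ cong (_+ ∑[ j ∈ 1 ⋯ suc n ] (f (suc n) * w j)) (sym (∑-∷ʳ-0 1 n _ (cancel (w (suc n)) F))) ⟩
  ∑[ j ∈ 1 ⋯ suc n ] (w j * (F - ∑ 1 (j ∸ 1) f)) + ∑[ j ∈ 1 ⋯ suc n ] (f (suc n) * w j)
    ≡⟨ ∑-+ 1 (suc n) _ _ ⟨
  ∑[ j ∈ 1 ⋯ suc n ] (w j * (F - ∑ 1 (j ∸ 1) f) + f (suc n) * w j)
    ≡⟨ ∑-cong (λ j _ _ → trans (collect (w j) F (∑ 1 (j ∸ 1) f) (f (suc n)))
                                (cong (λ x → w j * (x - ∑ 1 (j ∸ 1) f)) (sym (∑-∷ʳ f (s≤s z≤n))))) ⟩
  ∑[ j ∈ 1 ⋯ suc n ] (w j * (∑ 1 (suc n) f - ∑ 1 (j ∸ 1) f)) ∎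
  where
  open ≡-Reasoning
  F : ℚ
  F = ∑ 1 n f
  cancel : ∀ a b → a * (b - b) ≡ 0ℚ
  cancel = solve-∀ ℚ-ring
  collect : ∀ a F G x → a * (F - G) + x * a ≡ a * ((F + x) - G)
  collect = solve-∀ ℚ-ring

binomialTransform : (ℕ → ℚ) → ℕ → ℚ
binomialTransform g n = ∑[ k ∈ 1 ⋯ n ] (C± n k * g k)

binomialTransform-∑inv : ∀ n g →
  binomialTransform (λ k → ∑[ j ∈ 1 ⋯ k ] (inv j * g j)) n ≡ inv n * binomialTransform g n
binomialTransform-∑inv zero    g = trans (∑-empty _ (s≤s z≤n)) (sym (ℚP.*-zeroˡ (binomialTransform g 0)))
binomialTransform-∑inv (suc m) g = begin
  ∑[ k ∈ 1 ⋯ suc m ] (C± (suc m) k * ∑[ j ∈ 1 ⋯ k ] (inv j * g j))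
    ≡⟨ ∑-by-parts (suc m) (C± (suc m)) (λ j → inv j * g j) ⟩
  ∑[ j ∈ 1 ⋯ suc m ] ((inv j * g j) * (∑ 1 (suc m) (C± (suc m)) - ∑ 1 (j ∸ 1) (C± (suc m))))
    ≡⟨ ∑-cong termwise ⟩
  ∑[ j ∈ 1 ⋯ suc m ] (inv (suc m) * (C± (suc m) j * g j))
    ≡⟨ ∑-*ˡ 1 (suc m) (inv (suc m)) _ ⟩
  inv (suc m) * binomialTransform g (suc m) ∎
  where
  open ≡-Reasoning
  termwise : ∀ j → 1 ≤ j → j ≤ suc m →
    (inv j * g j) * (∑ 1 (suc m) (C± (suc m)) - ∑ 1 (j ∸ 1) (C± (suc m))) ≡ inv (suc m) * (C± (suc m) j * g j)
  termwise (suc j) _ _ = begin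
    (inv (suc j) * g (suc j)) * (∑ 1 (suc m) (C± (suc m)) - ∑ 1 j (C± (suc m)))
      ≡⟨ cong₂ (λ x y → (inv (suc j) * g (suc j)) * (x - y)) (C±-row-sum m) (shift (∑ 1 j (C± (suc m)))) ⟩
    (inv (suc j) * g (suc j)) * (- 1ℚ - ((1ℚ + ∑ 1 j (C± (suc m))) - 1ℚ))
      ≡⟨ cong (λ x → (inv (suc j) * g (suc j)) * (- 1ℚ - (x - 1ℚ))) (C±-partial-sum m j) ⟩
    (inv (suc j) * g (suc j)) * (- 1ℚ - (C± m j - 1ℚ))
      ≡⟨ simplify (inv (suc j)) (g (suc j)) (C± m j) ⟩
    - (inv (suc j) * C± m j) * g (suc j)
      ≡⟨ cong (λ x → - x * g (suc j)) (C±-absorption-inv m j) ⟩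
    - - (inv (suc m) * C± (suc m) (suc j)) * g (suc j)
      ≡⟨ reassociate (inv (suc m)) (C± (suc m) (suc j)) (g (suc j)) ⟩
    inv (suc m) * (C± (suc m) (suc j) * g (suc j)) ∎
    where
    shift : ∀ a → a ≡ (1ℚ + a) - 1ℚ
    shift = solve-∀ ℚ-ring
    simplify : ∀ u g c → (u * g) * (- 1ℚ - (c - 1ℚ)) ≡ - (u * c) * g
    simplify = solve-∀ ℚ-ring
    reassociate : ∀ v c g → - - (v * c) * g ≡ v * (c * g)
    reassociate = solve-∀ ℚ-ring

∑inv-binomialTransform : ∀ n h →
  ∑[ j ∈ 1 ⋯ n ] (inv j * binomialTransform h j) ≡ binomialTransform (λ k → inv k * h k) n
∑inv-binomialTransform zero    h = trans (∑-empty _ (s≤s z≤n)) (sym (∑-empty _ (s≤s z≤n)))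
∑inv-binomialTransform (suc m) h = begin
  ∑[ j ∈ 1 ⋯ suc m ] (inv j * binomialTransform h j)
    ≡⟨ ∑-∷ʳ _ (s≤s z≤n) ⟩
  ∑[ j ∈ 1 ⋯ m ] (inv j * binomialTransform h j) + inv (suc m) * binomialTransform h (suc m)
    ≡⟨ cong₂ _+_ (trans (∑inv-binomialTransform m h) (sym (∑-∷ʳ-0 1 m _ top-vanishes)))
                 (sym (∑-*ˡ 1 (suc m) (inv (suc m)) _)) ⟩
  ∑[ k ∈ 1 ⋯ suc m ] (C± m k * (inv k * h k)) + ∑[ k ∈ 1 ⋯ suc m ] (inv (suc m) * (C± (suc m) k * h k))
    ≡⟨ ∑-+ 1 (suc m) _ _ ⟨
  ∑[ k ∈ 1 ⋯ suc m ] (C± m k * (inv k * h k) + inv (suc m) * (C± (suc m) k * h k))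
    ≡⟨ ∑-cong termwise ⟩
  binomialTransform (λ k → inv k * h k) (suc m) ∎
  where
  open ≡-Reasoning
  top-vanishes : C± m (suc m) * (inv (suc m) * h (suc m)) ≡ 0ℚ
  top-vanishes = trans (cong (_* (inv (suc m) * h (suc m))) (C±-vanish m (suc m) (ℕP.n<1+n m))) (ℚP.*-zeroˡ (inv (suc m) * h (suc m)))
  termwise : ∀ k → 1 ≤ k → k ≤ suc m →
    C± m k * (inv k * h k) + inv (suc m) * (C± (suc m) k * h k) ≡ C± (suc m) k * (inv k * h k)
  termwise (suc k) _ _ = begin
    C± m (suc k) * (u * h (suc k)) + inv (suc m) * (C± (suc m) (suc k) * h (suc k))
      ≡⟨ negate (C± m (suc k)) u (h (suc k)) (inv (suc m)) (C± (suc m) (suc k)) ⟩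
    C± m (suc k) * (u * h (suc k)) - - (inv (suc m) * C± (suc m) (suc k)) * h (suc k)
      ≡⟨ cong (λ x → C± m (suc k) * (u * h (suc k)) - x * h (suc k)) (sym (C±-absorption-inv m k)) ⟩
    C± m (suc k) * (u * h (suc k)) - (u * C± m k) * h (suc k)
      ≡⟨ collect (C± m (suc k)) u (h (suc k)) (C± m k) ⟩
    (C± m (suc k) - C± m k) * (u * h (suc k)) ∎
    where
    u : ℚ
    u = inv (suc k)
    negate : ∀ b u h v c → b * (u * h) + v * (c * h) ≡ b * (u * h) - - (v * c) * h
    negate = solve-∀ ℚ-ring
    collect : ∀ b u h d → b * (u * h) - (u * d) * h ≡ (b - d) * (u * h)
    collect = solve-∀ ℚ-ring

-- Composites and their duals

IsCons : {A : Set} → List A → Set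
IsCons {A} xs = Σ A λ c → Σ (List A) λ ys → xs ≡ c ∷ ys

replicateFalse-∷ʳ : ∀ a → replicateFalse (suc a) ≡ replicateFalse a ∷ʳ false
replicateFalse-∷ʳ zero    = refl
replicateFalse-∷ʳ (suc a) = cong (false ∷_) (replicateFalse-∷ʳ a)

P-∷-++ : ∀ x s c (d : Composite) → P (x ∷ (s ++ c ∷ d)) ≡ replicateFalse (x ∸ 1) ++ true ∷ P (s ++ c ∷ d)
P-∷-++ x []      c d = refl
P-∷-++ x (y ∷ s) c d = refl

P-∷ʳ-extend : ∀ (s : Composite) {c c′ d d′} e → P (s ++ c ∷ d) ≡ P (s ++ c′ ∷ d′) ∷ʳ e →
  ∀ x → P (x ∷ s ++ c ∷ d) ≡ P (x ∷ s ++ c′ ∷ d′) ∷ʳ e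
P-∷ʳ-extend s {c} {c′} {d} {d′} e eq x = begin
  P (x ∷ s ++ c ∷ d)                                        ≡⟨ P-∷-++ x s c d ⟩
  replicateFalse (x ∸ 1) ++ true ∷ P (s ++ c ∷ d)           ≡⟨ cong (λ z → replicateFalse (x ∸ 1) ++ true ∷ z) eq ⟩
  replicateFalse (x ∸ 1) ++ true ∷ (P (s ++ c′ ∷ d′) ∷ʳ e)  ≡⟨ List.++-assoc (replicateFalse (x ∸ 1)) _ _ ⟨
  (replicateFalse (x ∸ 1) ++ true ∷ P (s ++ c′ ∷ d′)) ∷ʳ e   ≡⟨ cong (_∷ʳ e) (P-∷-++ x s c′ d′) ⟨
  P (x ∷ s ++ c′ ∷ d′) ∷ʳ e                                 ∎
  where open ≡-Reasoning

P-∷ʳ-suc : ∀ s a → P (s ++ suc (suc a) ∷ []) ≡ P (s ++ suc a ∷ []) ∷ʳ false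
P-∷ʳ-suc []      a = replicateFalse-∷ʳ a
P-∷ʳ-suc (x ∷ s) a = P-∷ʳ-extend s false (P-∷ʳ-suc s a) x

P-∷ʳ-1 : ∀ s b → P (s ++ suc b ∷ 1 ∷ []) ≡ P (s ++ suc b ∷ []) ∷ʳ true
P-∷ʳ-1 []      b = refl
P-∷ʳ-1 (x ∷ s) b = P-∷ʳ-extend s true (P-∷ʳ-1 s b) x

incrementLast : Composite → Composite
incrementLast []          = []
incrementLast (x ∷ [])    = suc x ∷ []
incrementLast (x ∷ y ∷ r) = x ∷ incrementLast (y ∷ r)

incrementHead : Composite → Composite
incrementHead []      = []
incrementHead (x ∷ r) = suc x ∷ r

incrementLast-∷ : ∀ c xs → IsCons xs → incrementLast (c ∷ xs) ≡ c ∷ incrementLast xs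
incrementLast-∷ c xs (y , r , refl) = refl

∷ʳ-IsCons : ∀ {A : Set} (xs : List A) y → IsCons (xs ∷ʳ y)
∷ʳ-IsCons []      y = y , [] , refl
∷ʳ-IsCons (c ∷ q) y = c , q ∷ʳ y , refl

reverse-∷-IsCons : ∀ {A : Set} (y : A) r → IsCons (reverse (y ∷ r))
reverse-∷-IsCons y r = subst IsCons (sym (List.unfold-reverse y r)) (∷ʳ-IsCons (reverse r) y)

fromSubsetAux-IsCons : ∀ c bs → IsCons (fromSubsetAux c bs)
fromSubsetAux-IsCons c []           = c , [] , refl
fromSubsetAux-IsCons c (true ∷ bs)  = c , fromSubsetAux 1 bs , refl
fromSubsetAux-IsCons c (false ∷ bs) = fromSubsetAux-IsCons (suc c) bs

fromSubsetAux-∷ʳ-true : ∀ c bs → fromSubsetAux c (bs ∷ʳ true) ≡ fromSubsetAux c bs ∷ʳ 1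
fromSubsetAux-∷ʳ-true c []           = refl
fromSubsetAux-∷ʳ-true c (true ∷ bs)  = cong (c ∷_) (fromSubsetAux-∷ʳ-true 1 bs)
fromSubsetAux-∷ʳ-true c (false ∷ bs) = fromSubsetAux-∷ʳ-true (suc c) bs

fromSubsetAux-∷ʳ-false : ∀ c bs → fromSubsetAux c (bs ∷ʳ false) ≡ incrementLast (fromSubsetAux c bs)
fromSubsetAux-∷ʳ-false c []           = refl
fromSubsetAux-∷ʳ-false c (true ∷ bs)  = trans (cong (c ∷_) (fromSubsetAux-∷ʳ-false 1 bs))
  (sym (incrementLast-∷ c _ (fromSubsetAux-IsCons 1 bs)))
fromSubsetAux-∷ʳ-false c (false ∷ bs) = fromSubsetAux-∷ʳ-false (suc c) bs

dual-++-suc : ∀ s a t → dual (s ++ suc a ∷ t) ≡ fromSubsetAux 1 (map not (P (s ++ suc a ∷ t)))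
dual-++-suc s a t = cong (λ w → fromSubset w (map not (P (s ++ suc a ∷ t))))
  (trans (sum-++ s (suc a ∷ t)) (ℕP.+-suc (weight s) (a ℕ.+ weight t)))

dual-∷ʳ-suc : ∀ s a → dual (s ++ suc (suc a) ∷ []) ≡ dual (s ++ suc a ∷ []) ∷ʳ 1
dual-∷ʳ-suc s a = begin
  dual (s ++ suc (suc a) ∷ [])                                ≡⟨ dual-++-suc s (suc a) [] ⟩
  fromSubsetAux 1 (map not (P (s ++ suc (suc a) ∷ [])))       ≡⟨ cong (fromSubsetAux 1 ∘ map not) (P-∷ʳ-suc s a) ⟩
  fromSubsetAux 1 (map not (P (s ++ suc a ∷ []) ∷ʳ false))    ≡⟨ cong (fromSubsetAux 1) (List.map-++ not (P (s ++ suc a ∷ [])) _) ⟩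
  fromSubsetAux 1 (map not (P (s ++ suc a ∷ [])) ∷ʳ true)     ≡⟨ fromSubsetAux-∷ʳ-true 1 (map not (P (s ++ suc a ∷ []))) ⟩
  fromSubsetAux 1 (map not (P (s ++ suc a ∷ []))) ∷ʳ 1        ≡⟨ cong (_∷ʳ 1) (dual-++-suc s a []) ⟨
  dual (s ++ suc a ∷ []) ∷ʳ 1                                 ∎
  where open ≡-Reasoning

dual-∷ʳ-1 : ∀ s b → dual (s ++ suc b ∷ 1 ∷ []) ≡ incrementLast (dual (s ++ suc b ∷ []))
dual-∷ʳ-1 s b = begin
  dual (s ++ suc b ∷ 1 ∷ [])                                  ≡⟨ dual-++-suc s b (1 ∷ []) ⟩
  fromSubsetAux 1 (map not (P (s ++ suc b ∷ 1 ∷ [])))         ≡⟨ cong (fromSubsetAux 1 ∘ map not) (P-∷ʳ-1 s b) ⟩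
  fromSubsetAux 1 (map not (P (s ++ suc b ∷ []) ∷ʳ true))     ≡⟨ cong (fromSubsetAux 1) (List.map-++ not (P (s ++ suc b ∷ [])) _) ⟩
  fromSubsetAux 1 (map not (P (s ++ suc b ∷ [])) ∷ʳ false)    ≡⟨ fromSubsetAux-∷ʳ-false 1 (map not (P (s ++ suc b ∷ []))) ⟩
  incrementLast (fromSubsetAux 1 (map not (P (s ++ suc b ∷ [])))) ≡⟨ cong incrementLast (dual-++-suc s b []) ⟨
  incrementLast (dual (s ++ suc b ∷ []))                      ∎
  where open ≡-Reasoning

-- The duality s ↦ s* read on reversed composites, so that it acts on the first entry.
dualʳ : Composite → Composite
dualʳ R = reverse (dual (reverse R))

dualʳ-suc : ∀ a R → dualʳ (suc (suc a) ∷ R) ≡ 1 ∷ dualʳ (suc a ∷ R)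
dualʳ-suc a R = begin
  reverse (dual (reverse (suc (suc a) ∷ R)))       ≡⟨ cong (reverse ∘ dual) (List.unfold-reverse (suc (suc a)) R) ⟩
  reverse (dual (reverse R ++ suc (suc a) ∷ []))   ≡⟨ cong reverse (dual-∷ʳ-suc (reverse R) a) ⟩
  reverse (dual (reverse R ++ suc a ∷ []) ∷ʳ 1)    ≡⟨ List.reverse-++ (dual (reverse R ++ suc a ∷ [])) _ ⟩
  1 ∷ reverse (dual (reverse R ++ suc a ∷ []))     ≡⟨ cong (λ z → 1 ∷ reverse (dual z)) (List.unfold-reverse (suc a) R) ⟨
  1 ∷ dualʳ (suc a ∷ R)                            ∎
  where open ≡-Reasoning

reverse-incrementLast : ∀ xs → reverse (incrementLast xs) ≡ incrementHead (reverse xs)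
reverse-incrementLast []          = refl
reverse-incrementLast (x ∷ [])    = refl
reverse-incrementLast (x ∷ y ∷ r) = begin
  reverse (x ∷ incrementLast (y ∷ r))              ≡⟨ List.unfold-reverse x (incrementLast (y ∷ r)) ⟩
  reverse (incrementLast (y ∷ r)) ∷ʳ x             ≡⟨ cong (_∷ʳ x) (reverse-incrementLast (y ∷ r)) ⟩
  incrementHead (reverse (y ∷ r)) ∷ʳ x             ≡⟨ incrementHead-∷ʳ (reverse (y ∷ r)) (reverse-∷-IsCons y r) ⟩
  incrementHead (reverse (y ∷ r) ∷ʳ x)             ≡⟨ cong incrementHead (List.unfold-reverse x (y ∷ r)) ⟨
  incrementHead (reverse (x ∷ y ∷ r))              ∎
  where
  open ≡-Reasoning
  incrementHead-∷ʳ : ∀ xs → IsCons xs → incrementHead xs ∷ʳ x ≡ incrementHead (xs ∷ʳ x)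
  incrementHead-∷ʳ xs (c , q , refl) = refl

dualʳ-1 : ∀ b R → dualʳ (1 ∷ suc b ∷ R) ≡ incrementHead (dualʳ (suc b ∷ R))
dualʳ-1 b R = begin
  reverse (dual (reverse (1 ∷ suc b ∷ R)))           ≡⟨ cong (reverse ∘ dual) reversed ⟩
  reverse (dual (reverse R ++ suc b ∷ 1 ∷ []))       ≡⟨ cong reverse (dual-∷ʳ-1 (reverse R) b) ⟩
  reverse (incrementLast (dual (reverse R ++ suc b ∷ []))) ≡⟨ reverse-incrementLast (dual (reverse R ++ suc b ∷ [])) ⟩
  incrementHead (reverse (dual (reverse R ++ suc b ∷ []))) ≡⟨ cong (λ z → incrementHead (reverse (dual z))) (List.unfold-reverse (suc b) R) ⟨
  incrementHead (dualʳ (suc b ∷ R))                  ∎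
  where
  open ≡-Reasoning
  reversed : reverse (1 ∷ suc b ∷ R) ≡ reverse R ++ suc b ∷ 1 ∷ []
  reversed = begin
    reverse (1 ∷ suc b ∷ R)         ≡⟨ List.unfold-reverse 1 (suc b ∷ R) ⟩
    reverse (suc b ∷ R) ∷ʳ 1        ≡⟨ cong (_∷ʳ 1) (List.unfold-reverse (suc b) R) ⟩
    (reverse R ∷ʳ suc b) ∷ʳ 1       ≡⟨ List.++-assoc (reverse R) _ _ ⟩
    reverse R ++ suc b ∷ 1 ∷ []     ∎

dualʳ-IsCons : ∀ a R → IsCons (dualʳ (suc a ∷ R))
dualʳ-IsCons a R with fromSubsetAux-IsCons 1 (map not (P (reverse R ++ suc a ∷ [])))
... | y , r , eq = subst IsCons (cong reverse (sym dual≡)) (reverse-∷-IsCons y r)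
  where
  dual≡ : dual (reverse (suc a ∷ R)) ≡ y ∷ r
  dual≡ = trans (cong dual (List.unfold-reverse (suc a) R)) (trans (dual-++-suc (reverse R) a []) eq)

All-reverse : ∀ {A : Set} {P : A → Set} {xs} → All P xs → All P (reverse xs)
All-reverse {xs = []}     []         = []
All-reverse {xs = x ∷ xs} (px ∷ pxs) = subst (All _) (sym (List.unfold-reverse x xs)) (AllP.∷ʳ⁺ (All-reverse pxs) px)

reverse-positive : ∀ a₀ s₀ → All (1 ≤_) (a₀ ∷ s₀) →
  Σ ℕ λ a → Σ Composite λ R → reverse (a₀ ∷ s₀) ≡ suc a ∷ R × All (1 ≤_) R
reverse-positive a₀ s₀ pos = split (reverse (a₀ ∷ s₀)) refl (All-reverse pos)
  where
  split : ∀ xs → reverse (a₀ ∷ s₀) ≡ xs → All (1 ≤_) xs →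
    Σ ℕ λ a → Σ Composite λ R → reverse (a₀ ∷ s₀) ≡ suc a ∷ R × All (1 ≤_) R
  split []          rev≡ _          with reverse-∷-IsCons a₀ s₀
  ... | c , R , eq with trans (sym rev≡) eq
  ...   | ()
  split (suc a ∷ R) rev≡ (_ ∷ posR) = a , R , rev≡ , posR

-- Hoffman's duality

-- Sfromʳ m R n = Sfrom (reverse R) m n: reversal lets the recursion peel off the last entry.
Sfromʳ : ℕ → Composite → ℕ → ℚ
Sfromʳ m []      n = 1ℚ
Sfromʳ m (a ∷ R) n = ∑[ k ∈ m ⋯ n ] (invPow k a * Sfromʳ m R k)

Sʳ : Composite → ℕ → ℚ
Sʳ = Sfromʳ 1

-- The terms of Sʳ R k whose largest summation index equals k.
Sʳ-top : Composite → ℕ → ℚ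
Sʳ-top []      k = 0ℚ
Sʳ-top (a ∷ R) k = invPow k a * Sʳ R k

Sʳ-top-suc : ∀ c Q k → Sʳ-top (suc c ∷ Q) k ≡ inv k * Sʳ-top (c ∷ Q) k
Sʳ-top-suc c Q k = trans (cong (_* Sʳ Q k) (invPow-suc k c)) (ℚP.*-assoc (inv k) (invPow k c) (Sʳ Q k))

Sʳ-suc : ∀ c Q n → Sʳ (suc c ∷ Q) n ≡ ∑[ k ∈ 1 ⋯ n ] (inv k * Sʳ-top (c ∷ Q) k)
Sʳ-suc c Q n = ∑-cong (λ k _ _ → Sʳ-top-suc c Q k)

HoffmanPair : Composite → Composite → Set
HoffmanPair R D = (∀ n → Sʳ R n ≡ - binomialTransform (Sʳ-top D) n)
                × (∀ n → Sʳ-top R n ≡ - binomialTransform (Sʳ D) n)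

HoffmanDual : Composite → Set
HoffmanDual R = HoffmanPair R (dualʳ R)

inv-*-neg-binomialTransform : ∀ (X g : ℕ → ℚ) n → X n ≡ - binomialTransform g n →
  inv n * X n ≡ - binomialTransform (λ k → ∑[ j ∈ 1 ⋯ k ] (inv j * g j)) n
inv-*-neg-binomialTransform X g n X≡ = begin
  inv n * X n                                  ≡⟨ cong (inv n *_) X≡ ⟩
  inv n * - binomialTransform g n              ≡⟨ ℚP.neg-distribʳ-* (inv n) _ ⟨
  - (inv n * binomialTransform g n)            ≡⟨ cong -_ (binomialTransform-∑inv n g) ⟨
  - binomialTransform (λ k → ∑[ j ∈ 1 ⋯ k ] (inv j * g j)) n ∎
  where open ≡-Reasoning

∑inv-neg-binomialTransform : ∀ (X g : ℕ → ℚ) n → (∀ j → 1 ≤ j → j ≤ n → X j ≡ - binomialTransform g j) →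
  ∑[ j ∈ 1 ⋯ n ] (inv j * X j) ≡ - binomialTransform (λ k → inv k * g k) n
∑inv-neg-binomialTransform X g n X≡ = begin
  ∑[ j ∈ 1 ⋯ n ] (inv j * X j)
    ≡⟨ ∑-cong (λ j 1≤j j≤n → trans (cong (inv j *_) (X≡ j 1≤j j≤n)) (sym (ℚP.neg-distribʳ-* (inv j) _))) ⟩
  ∑[ j ∈ 1 ⋯ n ] (- (inv j * binomialTransform g j)) ≡⟨ ∑-neg 1 n _ ⟩
  - ∑[ j ∈ 1 ⋯ n ] (inv j * binomialTransform g j)   ≡⟨ cong -_ (∑inv-binomialTransform n g) ⟩
  - binomialTransform (λ k → inv k * g k) n           ∎
  where open ≡-Reasoning

binomialTransform-1 : ∀ m → binomialTransform (λ _ → 1ℚ) (suc m) ≡ - 1ℚ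
binomialTransform-1 m = trans (∑-cong (λ k _ _ → ℚP.*-identityʳ (C± (suc m) k))) (C±-row-sum m)

one≡-binomialTransform-1 : ∀ j → 1 ≤ j → 1ℚ ≡ - binomialTransform (λ _ → 1ℚ) j
one≡-binomialTransform-1 (suc m) _ = sym (cong -_ (binomialTransform-1 m))

hoffmanDual-1 : HoffmanDual (1 ∷ [])
hoffmanDual-1 = (λ n → ∑inv-neg-binomialTransform (λ _ → 1ℚ) (λ _ → 1ℚ) n (λ j 1≤j _ → one≡-binomialTransform-1 j 1≤j)) , top
  where
  top : ∀ n → inv n * 1ℚ ≡ - binomialTransform (λ k → ∑[ j ∈ 1 ⋯ k ] (inv j * 1ℚ)) n
  top zero    = sym (cong -_ (∑-empty _ (s≤s z≤n)))
  top (suc m) = inv-*-neg-binomialTransform (λ _ → 1ℚ) (λ _ → 1ℚ) (suc m) (one≡-binomialTransform-1 (suc m) (s≤s z≤n))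

-- Induction on the last part: raising it prepends a part 1 to the dual,
-- and appending a part 1 raises the last part of the dual.
hoffmanDual : ∀ a R → All (1 ≤_) R → HoffmanDual (suc a ∷ R)
hoffmanDual zero    []          _         = hoffmanDual-1
hoffmanDual zero    (suc b ∷ R) (_ ∷ pos) with dualʳ-IsCons b R | hoffmanDual b R pos
... | c , Q , D≡ | hA , _ = subst (HoffmanPair (1 ∷ r)) (sym (trans (dualʳ-1 b R) (cong incrementHead D≡)))
  ( (λ n → trans (∑inv-neg-binomialTransform (Sʳ r) (Sʳ-top (c ∷ Q)) n (λ j _ _ → hA′ j))
                 (cong -_ (∑-cong (λ k _ _ → cong (C± n k *_) (sym (Sʳ-top-suc c Q k))))))
  , (λ n → trans (inv-*-neg-binomialTransform (Sʳ r) (Sʳ-top (c ∷ Q)) n (hA′ n))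
                 (cong -_ (∑-cong (λ k _ _ → cong (C± n k *_) (sym (Sʳ-suc c Q k)))))) )
  where
  r : Composite
  r = suc b ∷ R
  hA′ : ∀ n → Sʳ r n ≡ - binomialTransform (Sʳ-top (c ∷ Q)) n
  hA′ n = subst (λ D → Sʳ r n ≡ - binomialTransform (Sʳ-top D) n) D≡ (hA n)
hoffmanDual (suc a) R pos with hoffmanDual a R pos
... | _ , hB = subst (HoffmanPair (suc (suc a) ∷ R)) (sym (dualʳ-suc a R))
  ( (λ n → trans (Sʳ-suc (suc a) R n) (∑inv-neg-binomialTransform (Sʳ-top r) (Sʳ (dualʳ r)) n (λ j _ _ → hB j)))
  , (λ n → trans (Sʳ-top-suc (suc a) R n) (inv-*-neg-binomialTransform (Sʳ-top r) (Sʳ (dualʳ r)) n (hB n))) )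
  where
  r : Composite
  r = suc a ∷ R

Sfrom-∷ : ∀ a s m N → Sfrom (a ∷ s) m N ≡ ∑[ k ∈ m ⋯ N ] (invPow k a * Sfrom s k N)
Sfrom-∷ a s m N = sym (∑-def m N _)

Sfromʳ-∷ʳ : ∀ R a m N → ∑[ k ∈ m ⋯ N ] (invPow k a * Sfromʳ k R N) ≡ Sfromʳ m (R ∷ʳ a) N
Sfromʳ-∷ʳ []      a m N = refl
Sfromʳ-∷ʳ (b ∷ R) a m N = begin
  ∑[ k ∈ m ⋯ N ] (invPow k a * ∑[ j ∈ k ⋯ N ] (invPow j b * Sfromʳ k R j))
    ≡⟨ ∑-cong (λ k _ _ → sym (∑-*ˡ k N (invPow k a) _)) ⟩
  ∑[ k ∈ m ⋯ N ] ∑[ j ∈ k ⋯ N ] (invPow k a * (invPow j b * Sfromʳ k R j))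
    ≡⟨ ∑-swap-≤ m N _ ⟩
  ∑[ j ∈ m ⋯ N ] ∑[ k ∈ m ⋯ j ] (invPow k a * (invPow j b * Sfromʳ k R j))
    ≡⟨ ∑-cong (λ j _ _ → trans (∑-cong (λ k _ _ → swap-factors (invPow k a) (invPow j b) _)) (∑-*ˡ m j (invPow j b) _)) ⟩
  ∑[ j ∈ m ⋯ N ] (invPow j b * ∑[ k ∈ m ⋯ j ] (invPow k a * Sfromʳ k R j))
    ≡⟨ ∑-cong (λ j _ _ → cong (invPow j b *_) (Sfromʳ-∷ʳ R a m j)) ⟩
  Sfromʳ m ((b ∷ R) ∷ʳ a) N ∎
  where open ≡-Reasoning

Sfrom-reverse : ∀ s m N → Sfrom s m N ≡ Sfromʳ m (reverse s) N
Sfrom-reverse []      m N = refl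
Sfrom-reverse (a ∷ s) m N = begin
  Sfrom (a ∷ s) m N                                        ≡⟨ Sfrom-∷ a s m N ⟩
  ∑[ k ∈ m ⋯ N ] (invPow k a * Sfrom s k N)                ≡⟨ ∑-cong (λ k _ _ → cong (invPow k a *_) (Sfrom-reverse s k N)) ⟩
  ∑[ k ∈ m ⋯ N ] (invPow k a * Sfromʳ k (reverse s) N)     ≡⟨ Sfromʳ-∷ʳ (reverse s) a m N ⟩
  Sfromʳ m (reverse s ∷ʳ a) N                              ≡⟨ cong (λ R → Sfromʳ m R N) (List.unfold-reverse a s) ⟨
  Sfromʳ m (reverse (a ∷ s)) N                             ∎
  where open ≡-Reasoning

S*-top : Composite → ℕ → ℚ
S*-top s = Sʳ-top (reverse (dual s))

dualʳ-of-reverse : ∀ s {R} → reverse s ≡ R → dualʳ R ≡ reverse (dual s)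
dualʳ-of-reverse s refl = cong (reverse ∘ dual) (List.reverse-involutive s)

S-hoffman : ∀ s a R → reverse s ≡ suc a ∷ R → All (1 ≤_) R → ∀ n → S s n ≡ - binomialTransform (S*-top s) n
S-hoffman s a R rev≡ posR n = begin
  S s n                                               ≡⟨ Sfrom-reverse s 1 n ⟩
  Sʳ (reverse s) n                                    ≡⟨ cong (λ R → Sʳ R n) rev≡ ⟩
  Sʳ (suc a ∷ R) n                                    ≡⟨ proj₁ (hoffmanDual a R posR) n ⟩
  - binomialTransform (Sʳ-top (dualʳ (suc a ∷ R))) n  ≡⟨ cong (λ D → - binomialTransform (Sʳ-top D) n) (dualʳ-of-reverse s rev≡) ⟩
  - binomialTransform (S*-top s) n                    ∎
  where open ≡-Reasoning

S-dual : ∀ s a R → reverse s ≡ suc a ∷ R → ∀ n → S (dual s) n ≡ ∑ 1 n (S*-top s)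
S-dual s a R rev≡ n = trans (Sfrom-reverse (dual s) 1 n) (Sʳ-IsCons (subst IsCons (dualʳ-of-reverse s rev≡) (dualʳ-IsCons a R)))
  where
  Sʳ-IsCons : ∀ {D} → IsCons D → Sʳ D n ≡ ∑ 1 n (Sʳ-top D)
  Sʳ-IsCons (c , Q , refl) = refl

-- Harmonic sums

harmonic : ℕ → ℚ
harmonic n = ∑ 1 n inv

-- Vanishes at k = n by Euler's identity ∑_{i ≤ n} (-1)^(i-1) (n choose i) / i = H_n.
harmonicBinomial : ℕ → ℕ → ℚ
harmonicBinomial n k = harmonic n + ∑[ i ∈ 1 ⋯ k ] (inv i * C± n i)

harmonicBinomial-∷ʳ : ∀ n k → harmonicBinomial n (suc k) ≡ harmonicBinomial n k + inv (suc k) * C± n (suc k)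
harmonicBinomial-∷ʳ n k = trans (cong (harmonic n +_) (∑-∷ʳ _ (s≤s z≤n))) (sym (ℚP.+-assoc (harmonic n) _ _))

harmonicBinomial-suc : ∀ n k → harmonicBinomial (suc n) k ≡ harmonicBinomial n k + inv (suc n) * C± n k
harmonicBinomial-suc n k = begin
  harmonic (suc n) + ∑[ i ∈ 1 ⋯ k ] (inv i * C± (suc n) i)
    ≡⟨ cong₂ _+_ (∑-∷ʳ inv (s≤s z≤n)) (∑-cong termwise) ⟩
  (harmonic n + v) + ∑[ i ∈ 1 ⋯ k ] (inv i * C± n i + v * C± (suc n) i)
    ≡⟨ cong ((harmonic n + v) +_) (∑-+ 1 k _ _) ⟩
  (harmonic n + v) + (∑[ i ∈ 1 ⋯ k ] (inv i * C± n i) + ∑[ i ∈ 1 ⋯ k ] (v * C± (suc n) i))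
    ≡⟨ cong (λ z → (harmonic n + v) + (∑[ i ∈ 1 ⋯ k ] (inv i * C± n i) + z)) (∑-*ˡ 1 k v (C± (suc n))) ⟩
  (harmonic n + v) + (∑[ i ∈ 1 ⋯ k ] (inv i * C± n i) + v * ∑ 1 k (C± (suc n)))
    ≡⟨ regroup (harmonic n) v _ _ ⟩
  harmonicBinomial n k + v * (1ℚ + ∑ 1 k (C± (suc n)))
    ≡⟨ cong (λ z → harmonicBinomial n k + v * z) (C±-partial-sum n k) ⟩
  harmonicBinomial n k + v * C± n k ∎
  where
  open ≡-Reasoning
  v : ℚ
  v = inv (suc n)
  regroup : ∀ h v s t → (h + v) + (s + v * t) ≡ (h + s) + v * (1ℚ + t)
  regroup = solve-∀ ℚ-ring
  termwise : ∀ i → 1 ≤ i → i ≤ k → inv i * C± (suc n) i ≡ inv i * C± n i + v * C± (suc n) i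
  termwise (suc i) _ _ = begin
    inv (suc i) * (C± n (suc i) - C± n i)                     ≡⟨ distrib (inv (suc i)) (C± n (suc i)) (C± n i) ⟩
    inv (suc i) * C± n (suc i) - inv (suc i) * C± n i         ≡⟨ cong (λ x → inv (suc i) * C± n (suc i) - x) (C±-absorption-inv n i) ⟩
    inv (suc i) * C± n (suc i) - - (v * C± (suc n) (suc i))   ≡⟨ sub-neg (inv (suc i) * C± n (suc i)) (v * C± (suc n) (suc i)) ⟩
    inv (suc i) * C± n (suc i) + v * C± (suc n) (suc i)       ∎
    where
    distrib : ∀ a b c → a * (b - c) ≡ a * b - a * c
    distrib = solve-∀ ℚ-ring
    sub-neg : ∀ a b → a - - b ≡ a + b
    sub-neg = solve-∀ ℚ-ring

harmonicBinomial-diag : ∀ n → harmonicBinomial n n ≡ 0ℚ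
harmonicBinomial-diag zero    = cong₂ _+_ (∑-empty inv (s≤s z≤n)) (∑-empty _ (s≤s z≤n))
harmonicBinomial-diag (suc n) = begin
  harmonicBinomial (suc n) (suc n)                                  ≡⟨ harmonicBinomial-∷ʳ (suc n) n ⟩
  harmonicBinomial (suc n) n + v * (C± n (suc n) - C± n n)
    ≡⟨ cong₂ (λ x y → x + v * (y - C± n n)) (harmonicBinomial-suc n n) (C±-vanish n (suc n) (ℕP.n<1+n n)) ⟩
  (harmonicBinomial n n + v * C± n n) + v * (0ℚ - C± n n)
    ≡⟨ cong (λ x → (x + v * C± n n) + v * (0ℚ - C± n n)) (harmonicBinomial-diag n) ⟩
  (0ℚ + v * C± n n) + v * (0ℚ - C± n n)                             ≡⟨ cancel v (C± n n) ⟩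
  0ℚ                                                                ∎
  where
  open ≡-Reasoning
  v : ℚ
  v = inv (suc n)
  cancel : ∀ v b → (0ℚ + v * b) + v * (0ℚ - b) ≡ 0ℚ
  cancel = solve-∀ ℚ-ring

∑inv-binomialTransform-pred : ∀ n φ →
  ∑[ j ∈ 1 ⋯ n ] (inv j * binomialTransform φ (j ∸ 1)) ≡ ∑[ k ∈ 1 ⋯ n ] (φ k * harmonicBinomial n k)
∑inv-binomialTransform-pred zero    φ = trans (∑-empty _ (s≤s z≤n)) (sym (∑-empty _ (s≤s z≤n)))
∑inv-binomialTransform-pred (suc n) φ = begin
  ∑[ j ∈ 1 ⋯ suc n ] (inv j * binomialTransform φ (j ∸ 1))
    ≡⟨ ∑-∷ʳ _ (s≤s z≤n) ⟩
  ∑[ j ∈ 1 ⋯ n ] (inv j * binomialTransform φ (j ∸ 1)) + v * binomialTransform φ n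
    ≡⟨ cong₂ _+_ (∑inv-binomialTransform-pred n φ) (sym (∑-*ˡ 1 n v _)) ⟩
  ∑[ k ∈ 1 ⋯ n ] (φ k * harmonicBinomial n k) + ∑[ k ∈ 1 ⋯ n ] (v * (C± n k * φ k))
    ≡⟨ ∑-+ 1 n _ _ ⟨
  ∑[ k ∈ 1 ⋯ n ] (φ k * harmonicBinomial n k + v * (C± n k * φ k))
    ≡⟨ ∑-cong (λ k _ _ → trans (factor (φ k) _ v (C± n k)) (cong (φ k *_) (sym (harmonicBinomial-suc n k)))) ⟩
  ∑[ k ∈ 1 ⋯ n ] (φ k * harmonicBinomial (suc n) k)
    ≡⟨ ∑-∷ʳ-0 1 n _ (trans (cong (φ (suc n) *_) (harmonicBinomial-diag (suc n))) (ℚP.*-zeroʳ (φ (suc n)))) ⟨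
  ∑[ k ∈ 1 ⋯ suc n ] (φ k * harmonicBinomial (suc n) k) ∎
  where
  open ≡-Reasoning
  v : ℚ
  v = inv (suc n)
  factor : ∀ f e v b → f * e + v * (b * f) ≡ f * (e + v * b)
  factor = solve-∀ ℚ-ring

-- Sums over coarsenings

Hfrom-∷ : ∀ a s m N → Hfrom (a ∷ s) m N ≡ ∑[ k ∈ suc m ⋯ N ] (invPow k a * Hfrom s k N)
Hfrom-∷ a s m N = sym (∑-def (suc m) N _)

∑-swap-<-factor : ∀ m N (A : ℕ → ℚ) (B : ℕ → ℕ → ℚ) →
  ∑[ k ∈ suc m ⋯ N ] (A k * ∑[ j ∈ suc k ⋯ N ] (inv j * B k j))
    ≡ ∑[ j ∈ suc m ⋯ N ] (inv j * ∑[ k ∈ suc m ⋯ j ∸ 1 ] (A k * B k j))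
∑-swap-<-factor m N A B = begin
  ∑[ k ∈ suc m ⋯ N ] (A k * ∑[ j ∈ suc k ⋯ N ] (inv j * B k j))
    ≡⟨ ∑-cong (λ k _ _ → sym (∑-*ˡ (suc k) N (A k) _)) ⟩
  ∑[ k ∈ suc m ⋯ N ] ∑[ j ∈ suc k ⋯ N ] (A k * (inv j * B k j))
    ≡⟨ ∑-swap-< m N _ ⟩
  ∑[ j ∈ suc m ⋯ N ] ∑[ k ∈ suc m ⋯ j ∸ 1 ] (A k * (inv j * B k j))
    ≡⟨ ∑-cong (λ j _ _ → trans (∑-cong (λ k _ _ → swap-factors (A k) (inv j) (B k j))) (∑-*ˡ (suc m) (j ∸ 1) (inv j) _)) ⟩
  ∑[ j ∈ suc m ⋯ N ] (inv j * ∑[ k ∈ suc m ⋯ j ∸ 1 ] (A k * B k j)) ∎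
  where open ≡-Reasoning

-- Splitting the right side by whether the index following k exceeds k or equals it gives the two terms on the left.
Hfrom-merge : ∀ a c X m N →
  Hfrom (a ∷ c ∷ X) m N + Hfrom ((a ℕ.+ c) ∷ X) m N ≡ ∑[ k ∈ suc m ⋯ N ] (invPow k a * Hfrom (c ∷ X) (k ∸ 1) N)
Hfrom-merge a c X m N = begin
  Hfrom (a ∷ c ∷ X) m N + Hfrom ((a ℕ.+ c) ∷ X) m N
    ≡⟨ cong₂ _+_ (Hfrom-∷ a (c ∷ X) m N) (Hfrom-∷ (a ℕ.+ c) X m N) ⟩
  ∑[ k ∈ suc m ⋯ N ] (invPow k a * Hfrom (c ∷ X) k N) + ∑[ k ∈ suc m ⋯ N ] (invPow k (a ℕ.+ c) * Hfrom X k N)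
    ≡⟨ ∑-+ (suc m) N _ _ ⟨
  ∑[ k ∈ suc m ⋯ N ] (invPow k a * Hfrom (c ∷ X) k N + invPow k (a ℕ.+ c) * Hfrom X k N)
    ≡⟨ ∑-cong termwise ⟩
  ∑[ k ∈ suc m ⋯ N ] (invPow k a * Hfrom (c ∷ X) (k ∸ 1) N) ∎
  where
  open ≡-Reasoning
  factor : ∀ A C H H′ → A * H + (A * C) * H′ ≡ A * (C * H′ + H)
  factor = solve-∀ ℚ-ring
  termwise : ∀ k → suc m ≤ k → k ≤ N →
    invPow k a * Hfrom (c ∷ X) k N + invPow k (a ℕ.+ c) * Hfrom X k N ≡ invPow k a * Hfrom (c ∷ X) (k ∸ 1) N
  termwise (suc k) _ k<N = begin
    invPow (suc k) a * Hfrom (c ∷ X) (suc k) N + invPow (suc k) (a ℕ.+ c) * Hfrom X (suc k) N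
      ≡⟨ cong (λ z → invPow (suc k) a * Hfrom (c ∷ X) (suc k) N + z * Hfrom X (suc k) N) (invPow-+ (suc k) a c) ⟩
    invPow (suc k) a * Hfrom (c ∷ X) (suc k) N + (invPow (suc k) a * invPow (suc k) c) * Hfrom X (suc k) N
      ≡⟨ factor (invPow (suc k) a) (invPow (suc k) c) _ _ ⟩
    invPow (suc k) a * (invPow (suc k) c * Hfrom X (suc k) N + Hfrom (c ∷ X) (suc k) N)
      ≡⟨ cong (λ z → invPow (suc k) a * (invPow (suc k) c * Hfrom X (suc k) N + z)) (Hfrom-∷ c X (suc k) N) ⟩
    invPow (suc k) a * (invPow (suc k) c * Hfrom X (suc k) N + ∑[ j ∈ suc (suc k) ⋯ N ] (invPow j c * Hfrom X j N))
      ≡⟨ cong (invPow (suc k) a *_) (trans (sym (∑-∷ _ k<N)) (sym (Hfrom-∷ c X k N))) ⟩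
    invPow (suc k) a * Hfrom (c ∷ X) k N ∎

coarsenings-IsCons : ∀ b s → All IsCons (coarsenings (b ∷ s))
coarsenings-IsCons b []      = (b , [] , refl) ∷ []
coarsenings-IsCons b (c ∷ s) = AllP.concat⁺ (AllP.map⁺ (All.universal
  (λ { []      → (b , [] , refl) ∷ []
     ; (x ∷ t) → (b , x ∷ t , refl) ∷ (b ℕ.+ x , t , refl) ∷ [] })
  (coarsenings (c ∷ s))))

Sfrom-below : ∀ b s k → Sfrom (b ∷ s) (suc k) k ≡ 0ℚ
Sfrom-below b s k = trans (Sfrom-∷ b s (suc k) k) (∑-empty _ ℕP.≤-refl)

coarsenings-Hfrom : ∀ a s m N →
  Σℚ (map (λ t → Hfrom (append1 t) m N) (coarsenings (a ∷ s)))
    ≡ ∑[ j ∈ suc m ⋯ N ] (inv j * Sfrom (a ∷ s) (suc m) (j ∸ 1))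
coarsenings-Hfrom a [] m N = begin
  Hfrom (a ∷ 1 ∷ []) m N + 0ℚ
    ≡⟨ trans (ℚP.+-identityʳ _) (Hfrom-∷ a (1 ∷ []) m N) ⟩
  ∑[ k ∈ suc m ⋯ N ] (invPow k a * Hfrom (1 ∷ []) k N)
    ≡⟨ ∑-cong (λ k _ _ → cong (invPow k a *_) (Hfrom-∷ 1 [] k N)) ⟩
  ∑[ k ∈ suc m ⋯ N ] (invPow k a * ∑[ j ∈ suc k ⋯ N ] (inv j * 1ℚ))
    ≡⟨ ∑-swap-<-factor m N (λ k → invPow k a) (λ _ _ → 1ℚ) ⟩
  ∑[ j ∈ suc m ⋯ N ] (inv j * ∑[ k ∈ suc m ⋯ j ∸ 1 ] (invPow k a * 1ℚ))
    ≡⟨ ∑-cong (λ j _ _ → cong (inv j *_) (sym (Sfrom-∷ a [] (suc m) (j ∸ 1)))) ⟩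
  ∑[ j ∈ suc m ⋯ N ] (inv j * Sfrom (a ∷ []) (suc m) (j ∸ 1)) ∎
  where open ≡-Reasoning
coarsenings-Hfrom a (b ∷ s) m N = begin
  Σℚ (map F (coarsenings (a ∷ b ∷ s)))
    ≡⟨ Σℚ-map-concatMap F _ L ⟩
  _ -- mentions mergeHead, which is local to coarsenings and cannot be named here
    ≡⟨ cong Σℚ (List.map-cong-local (All.map (λ { (c , t′ , refl) → merge c t′ }) (coarsenings-IsCons b s))) ⟩
  Σℚ (map (λ t → ∑[ k ∈ suc m ⋯ N ] (invPow k a * Hfrom (append1 t) (k ∸ 1) N)) L)
    ≡⟨ ∑-Σℚ-comm (suc m) N _ L ⟩
  ∑[ k ∈ suc m ⋯ N ] Σℚ (map (λ t → invPow k a * Hfrom (append1 t) (k ∸ 1) N) L)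
    ≡⟨ ∑-cong (λ k _ _ → Σℚ-map-*ˡ (invPow k a) _ L) ⟩
  ∑[ k ∈ suc m ⋯ N ] (invPow k a * Σℚ (map (λ t → Hfrom (append1 t) (k ∸ 1) N) L))
    ≡⟨ ∑-cong (λ k m<k k≤N → cong (invPow k a *_) (inner k m<k k≤N)) ⟩
  ∑[ k ∈ suc m ⋯ N ] (invPow k a * ∑[ j ∈ suc k ⋯ N ] (inv j * Sfrom (b ∷ s) k (j ∸ 1)))
    ≡⟨ ∑-swap-<-factor m N (λ k → invPow k a) (λ k j → Sfrom (b ∷ s) k (j ∸ 1)) ⟩
  ∑[ j ∈ suc m ⋯ N ] (inv j * ∑[ k ∈ suc m ⋯ j ∸ 1 ] (invPow k a * Sfrom (b ∷ s) k (j ∸ 1)))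
    ≡⟨ ∑-cong (λ j _ _ → cong (inv j *_) (sym (Sfrom-∷ a (b ∷ s) (suc m) (j ∸ 1)))) ⟩
  ∑[ j ∈ suc m ⋯ N ] (inv j * Sfrom (a ∷ b ∷ s) (suc m) (j ∸ 1)) ∎
  where
  open ≡-Reasoning
  F : Composite → ℚ
  F t = Hfrom (append1 t) m N
  L : List Composite
  L = coarsenings (b ∷ s)
  merge : ∀ c t′ → F (a ∷ c ∷ t′) + (F ((a ℕ.+ c) ∷ t′) + 0ℚ)
                   ≡ ∑[ k ∈ suc m ⋯ N ] (invPow k a * Hfrom (append1 (c ∷ t′)) (k ∸ 1) N)
  merge c t′ = trans (cong (F (a ∷ c ∷ t′) +_) (ℚP.+-identityʳ _)) (Hfrom-merge a c (append1 t′) m N)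
  inner : ∀ k → suc m ≤ k → k ≤ N →
    Σℚ (map (λ t → Hfrom (append1 t) (k ∸ 1) N) L) ≡ ∑[ j ∈ suc k ⋯ N ] (inv j * Sfrom (b ∷ s) k (j ∸ 1))
  inner (suc k) _ k<N = begin
    Σℚ (map (λ t → Hfrom (append1 t) k N) L)                  ≡⟨ coarsenings-Hfrom b s k N ⟩
    ∑[ j ∈ suc k ⋯ N ] (inv j * Sfrom (b ∷ s) (suc k) (j ∸ 1)) ≡⟨ ∑-∷ _ k<N ⟩
    inv (suc k) * Sfrom (b ∷ s) (suc k) k + rest               ≡⟨ cong (λ x → inv (suc k) * x + rest) (Sfrom-below b s k) ⟩
    inv (suc k) * 0ℚ + rest                                    ≡⟨ cong (_+ rest) (ℚP.*-zeroʳ (inv (suc k))) ⟩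
    0ℚ + rest                                                  ≡⟨ ℚP.+-identityˡ rest ⟩
    rest                                                       ∎
    where
    rest : ℚ
    rest = ∑[ j ∈ suc (suc k) ⋯ N ] (inv j * Sfrom (b ∷ s) (suc k) (j ∸ 1))

coarsenings-H : ∀ a s N φ → (∀ n → S (a ∷ s) n ≡ - binomialTransform φ n) →
  Σℚ (map (λ t → H (append1 t) N) (coarsenings (a ∷ s))) ≡ - ∑[ k ∈ 1 ⋯ N ] (φ k * harmonicBinomial N k)
coarsenings-H a s N φ S≡ = begin
  Σℚ (map (λ t → H (append1 t) N) (coarsenings (a ∷ s)))      ≡⟨ coarsenings-Hfrom a s 0 N ⟩
  ∑[ j ∈ 1 ⋯ N ] (inv j * S (a ∷ s) (j ∸ 1))
    ≡⟨ ∑-cong (λ j _ _ → trans (cong (inv j *_) (S≡ (j ∸ 1))) (sym (ℚP.neg-distribʳ-* (inv j) _))) ⟩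
  ∑[ j ∈ 1 ⋯ N ] (- (inv j * binomialTransform φ (j ∸ 1)))    ≡⟨ ∑-neg 1 N _ ⟩
  - ∑[ j ∈ 1 ⋯ N ] (inv j * binomialTransform φ (j ∸ 1))      ≡⟨ cong -_ (∑inv-binomialTransform-pred N φ) ⟩
  - ∑[ k ∈ 1 ⋯ N ] (φ k * harmonicBinomial N k)              ∎
  where open ≡-Reasoning

-- Congruences modulo p²

binomialRemainder : ℕ → ℕ → ℚ
binomialRemainder N k = ∑[ i ∈ 1 ⋯ k ] (inv i * inv i * C± N (i ∸ 1))

harmonicQuotient : ℕ → ℚ
harmonicQuotient N = ½ * ∑[ j ∈ 1 ⋯ N ] (inv j * inv (suc N ∸ j))

C±-congruence : ∀ N k →
  C± N k - 1ℚ + fromℕ (suc N) * ∑[ i ∈ 1 ⋯ k ] (inv i * C± N i)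
    ≡ - (fromℕ (suc N) * fromℕ (suc N) * binomialRemainder N k)
C±-congruence N zero = begin
  1ℚ - 1ℚ + p * ∑[ i ∈ 1 ⋯ 0 ] (inv i * C± N i)                ≡⟨ cong (λ x → 1ℚ - 1ℚ + p * x) (∑-empty _ (s≤s z≤n)) ⟩
  1ℚ - 1ℚ + p * 0ℚ                                            ≡⟨ vanish p ⟩
  - (p * p * 0ℚ)                                              ≡⟨ cong (λ x → - (p * p * x)) (∑-empty _ (s≤s z≤n)) ⟨
  - (p * p * binomialRemainder N 0)                           ∎
  where
  open ≡-Reasoning
  p : ℚ
  p = fromℕ (suc N)
  vanish : ∀ p → 1ℚ - 1ℚ + p * 0ℚ ≡ - (p * p * 0ℚ)
  vanish = solve-∀ ℚ-ring
C±-congruence N (suc k) = begin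
  C± N (suc k) - 1ℚ + p * ∑[ i ∈ 1 ⋯ suc k ] (inv i * C± N i)
    ≡⟨ cong (λ z → C± N (suc k) - 1ℚ + p * z) (∑-∷ʳ _ (s≤s z≤n)) ⟩
  C± N (suc k) - 1ℚ + p * (A + v * C± N (suc k))
    ≡⟨ cong (λ z → z - 1ℚ + p * (A + v * z)) (C±-ratio N k) ⟩
  (1ℚ - p * v) * c - 1ℚ + p * (A + v * ((1ℚ - p * v) * c))
    ≡⟨ expand p v c A ⟩
  (c - 1ℚ + p * A) - p * p * (v * v * c)
    ≡⟨ cong (λ z → z - p * p * (v * v * c)) (C±-congruence N k) ⟩
  - (p * p * B) - p * p * (v * v * c)
    ≡⟨ collect p B (v * v * c) ⟩
  - (p * p * (B + v * v * c))
    ≡⟨ cong (λ z → - (p * p * z)) (∑-∷ʳ _ (s≤s z≤n)) ⟨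
  - (p * p * binomialRemainder N (suc k)) ∎
  where
  open ≡-Reasoning
  p : ℚ
  p = fromℕ (suc N)
  v : ℚ
  v = inv (suc k)
  c : ℚ
  c = C± N k
  A : ℚ
  A = ∑[ i ∈ 1 ⋯ k ] (inv i * C± N i)
  B : ℚ
  B = binomialRemainder N k
  expand : ∀ p v c A → (1ℚ - p * v) * c - 1ℚ + p * (A + v * ((1ℚ - p * v) * c)) ≡ (c - 1ℚ + p * A) - p * p * (v * v * c)
  expand = solve-∀ ℚ-ring
  collect : ∀ p B x → - (p * p * B) - p * p * x ≡ - (p * p * (B + x))
  collect = solve-∀ ℚ-ring

-- Pairing 1/j with 1/(N+1-j) exhibits the factor N+1 in H_N.
harmonic-reflect : ∀ N → harmonic N ≡ fromℕ (suc N) * harmonicQuotient N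
harmonic-reflect N = begin
  harmonic N                                                   ≡⟨ half (harmonic N) ⟨
  ½ * (harmonic N + harmonic N)                                ≡⟨ cong (λ z → ½ * (harmonic N + z)) (∑-reflect N inv) ⟩
  ½ * (∑ 1 N inv + ∑[ j ∈ 1 ⋯ N ] inv (suc N ∸ j))             ≡⟨ cong (½ *_) (∑-+ 1 N inv _) ⟨
  ½ * ∑[ j ∈ 1 ⋯ N ] (inv j + inv (suc N ∸ j))                 ≡⟨ cong (½ *_) (∑-cong pair) ⟩
  ½ * ∑[ j ∈ 1 ⋯ N ] (p * (inv j * inv (suc N ∸ j)))           ≡⟨ cong (½ *_) (∑-*ˡ 1 N p _) ⟩
  ½ * (p * ∑[ j ∈ 1 ⋯ N ] (inv j * inv (suc N ∸ j)))           ≡⟨ swap-factors ½ p _ ⟩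
  p * (½ * ∑[ j ∈ 1 ⋯ N ] (inv j * inv (suc N ∸ j)))           ∎
  where
  open ≡-Reasoning
  p : ℚ
  p = fromℕ (suc N)
  half : ∀ x → ½ * (x + x) ≡ x
  half x = trans (double x ½) (ℚP.*-identityˡ x)
    where
    double : ∀ x h → h * (x + x) ≡ (h + h) * x
    double = solve-∀ ℚ-ring
  inv-+-inv : ∀ a b → inv (suc a) + inv (suc b) ≡ fromℕ (suc a ℕ.+ suc b) * (inv (suc a) * inv (suc b))
  inv-+-inv a b = begin
    u + w
      ≡⟨ cong₂ _+_ (cancel-inverse w (fromℕ (suc b)) u (inv-inverse b)) (cancel-inverse u (fromℕ (suc a)) w (inv-inverse a)) ⟨
    w * (fromℕ (suc b) * u) + u * (fromℕ (suc a) * w) ≡⟨ collect u w (fromℕ (suc a)) (fromℕ (suc b)) ⟩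
    (fromℕ (suc a) + fromℕ (suc b)) * (u * w) ≡⟨ cong (_* (u * w)) (fromℕ-+ (suc a) (suc b)) ⟨
    fromℕ (suc a ℕ.+ suc b) * (u * w)        ∎
    where
    u : ℚ
    u = inv (suc a)
    w : ℚ
    w = inv (suc b)
    collect : ∀ u w x y → w * (y * u) + u * (x * w) ≡ (x + y) * (u * w)
    collect = solve-∀ ℚ-ring
  pair : ∀ j → 1 ≤ j → j ≤ N → inv j + inv (suc N ∸ j) ≡ p * (inv j * inv (suc N ∸ j))
  pair (suc j) _ j<N = begin
    inv (suc j) + inv (suc N ∸ suc j)                          ≡⟨ cong (λ z → inv (suc j) + inv z) N+1-j ⟩
    inv (suc j) + inv (suc (N ∸ suc j))                        ≡⟨ inv-+-inv j (N ∸ suc j) ⟩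
    fromℕ (suc j ℕ.+ suc (N ∸ suc j)) * (inv (suc j) * inv (suc (N ∸ suc j)))
      ≡⟨ cong₂ (λ x y → fromℕ x * (inv (suc j) * inv y)) sum≡ (sym N+1-j) ⟩
    p * (inv (suc j) * inv (suc N ∸ suc j))                    ∎
    where
    N+1-j : suc N ∸ suc j ≡ suc (N ∸ suc j)
    N+1-j = ℕP.+-∸-assoc 1 j<N
    sum≡ : suc j ℕ.+ suc (N ∸ suc j) ≡ suc N
    sum≡ = trans (cong (suc j ℕ.+_) (sym N+1-j)) (ℕP.m+[n∸m]≡n (ℕP.m≤n⇒m≤1+n j<N))

C±-harmonicBinomial-congruence : ∀ N k →
  C± N k - 1ℚ + fromℕ (suc N) * harmonicBinomial N k
    ≡ fromℕ (suc N) * fromℕ (suc N) * (harmonicQuotient N - binomialRemainder N k)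
C±-harmonicBinomial-congruence N k = begin
  C± N k - 1ℚ + p * (harmonic N + A)          ≡⟨ regroup (C± N k) p (harmonic N) A ⟩
  (C± N k - 1ℚ + p * A) + p * harmonic N      ≡⟨ cong₂ (λ x y → x + p * y) (C±-congruence N k) (harmonic-reflect N) ⟩
  - (p * p * W) + p * (p * Q)                 ≡⟨ collect p W Q ⟩
  p * p * (Q - W)                             ∎
  where
  open ≡-Reasoning
  p : ℚ
  p = fromℕ (suc N)
  A : ℚ
  A = ∑[ i ∈ 1 ⋯ k ] (inv i * C± N i)
  W : ℚ
  W = binomialRemainder N k
  Q : ℚ
  Q = harmonicQuotient N
  regroup : ∀ c p h a → c - 1ℚ + p * (h + a) ≡ (c - 1ℚ + p * a) + p * h
  regroup = solve-∀ ℚ-ring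
  collect : ∀ p w q → - (p * p * w) + p * (p * q) ≡ p * p * (q - w)
  collect = solve-∀ ℚ-ring

congruence-combination : ∀ N (φ : ℕ → ℚ) →
  (- ∑ 1 N φ) - (- binomialTransform φ N + fromℕ (suc N) * - ∑[ k ∈ 1 ⋯ N ] (φ k * harmonicBinomial N k))
    ≡ fromℕ (suc N) * fromℕ (suc N) * ∑[ k ∈ 1 ⋯ N ] (φ k * (harmonicQuotient N - binomialRemainder N k))
congruence-combination N φ = begin
  (- ∑ 1 N φ) - (- binomialTransform φ N + p * - ∑[ k ∈ 1 ⋯ N ] (φ k * E k))
    ≡⟨ regroup p (∑ 1 N φ) (binomialTransform φ N) _ ⟩
  binomialTransform φ N + (- ∑ 1 N φ + p * ∑[ k ∈ 1 ⋯ N ] (φ k * E k))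
    ≡⟨ cong₂ (λ x y → binomialTransform φ N + (x + y)) (sym (∑-neg 1 N φ)) (sym (∑-*ˡ 1 N p _)) ⟩
  binomialTransform φ N + (∑[ k ∈ 1 ⋯ N ] (- φ k) + ∑[ k ∈ 1 ⋯ N ] (p * (φ k * E k)))
    ≡⟨ cong (binomialTransform φ N +_) (∑-+ 1 N _ _) ⟨
  binomialTransform φ N + ∑[ k ∈ 1 ⋯ N ] (- φ k + p * (φ k * E k))
    ≡⟨ ∑-+ 1 N _ _ ⟨
  ∑[ k ∈ 1 ⋯ N ] (C± N k * φ k + (- φ k + p * (φ k * E k)))
    ≡⟨ ∑-cong (λ k _ _ → trans (factor p (φ k) (C± N k) (E k)) (cong (φ k *_) (C±-harmonicBinomial-congruence N k))) ⟩
  ∑[ k ∈ 1 ⋯ N ] (φ k * (p * p * (harmonicQuotient N - binomialRemainder N k)))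
    ≡⟨ ∑-cong (λ k _ _ → swap-factors (φ k) (p * p) _) ⟩
  ∑[ k ∈ 1 ⋯ N ] (p * p * (φ k * (harmonicQuotient N - binomialRemainder N k)))
    ≡⟨ ∑-*ˡ 1 N (p * p) _ ⟩
  p * p * ∑[ k ∈ 1 ⋯ N ] (φ k * (harmonicQuotient N - binomialRemainder N k)) ∎
  where
  open ≡-Reasoning
  p : ℚ
  p = fromℕ (suc N)
  E : ℕ → ℚ
  E = harmonicBinomial N
  regroup : ∀ p a b c → (- a) - (- b + p * - c) ≡ b + (- a + p * c)
  regroup = solve-∀ ℚ-ring
  factor : ∀ p f c e → c * f + (- f + p * (f * e)) ≡ f * (c - 1ℚ + p * e)
  factor = solve-∀ ℚ-ring

-- p-integral rationals

prime²-∣ : ∀ {p} → Prime p → ∀ d n m → ¬ p ∣ d → d ℕ.* n ≡ p ℕ.* (p ℕ.* m) → p ^ 2 ∣ n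
prime²-∣ {p} p-prime d n m p∤d dn≡ppm = divides r (begin
  n                   ≡⟨ n≡qp ⟩
  q ℕ.* p             ≡⟨ cong (ℕ._* p) q≡rp ⟩
  r ℕ.* p ℕ.* p       ≡⟨ square r p ⟩
  r ℕ.* p ^ 2         ∎)
  where
  open ≡-Reasoning
  instance _ = prime⇒nonZero p-prime
  p∣d*⇒p∣ : ∀ y → p ∣ d ℕ.* y → p ∣ y
  p∣d*⇒p∣ y p∣dy = [ (λ p∣d → ⊥-elim (p∤d p∣d)) , (λ p∣y → p∣y) ]′ (euclidsLemma d y p-prime p∣dy)
  square : ∀ r p → r ℕ.* p ℕ.* p ≡ r ℕ.* (p ℕ.* (p ℕ.* 1))
  square = ℕSolver.solve-∀
  p∣n : p ∣ n
  p∣n = p∣d*⇒p∣ n (divides (p ℕ.* m) (trans dn≡ppm (ℕP.*-comm p (p ℕ.* m))))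
  q : ℕ
  q = quotient p∣n
  n≡qp : n ≡ q ℕ.* p
  n≡qp = _∣_.equality p∣n
  dq≡pm : d ℕ.* q ≡ p ℕ.* m
  dq≡pm = ℕP.*-cancelˡ-≡ (d ℕ.* q) (p ℕ.* m) p (begin
    p ℕ.* (d ℕ.* q)     ≡⟨ rotate p d q ⟩
    d ℕ.* (q ℕ.* p)     ≡⟨ cong (d ℕ.*_) n≡qp ⟨
    d ℕ.* n             ≡⟨ dn≡ppm ⟩
    p ℕ.* (p ℕ.* m)     ∎)
    where
    rotate : ∀ p d q → p ℕ.* (d ℕ.* q) ≡ d ℕ.* (q ℕ.* p)
    rotate = ℕSolver.solve-∀
  p∣q : p ∣ q
  p∣q = p∣d*⇒p∣ q (divides m (trans dq≡pm (ℕP.*-comm p m)))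
  r : ℕ
  r = quotient p∣q
  q≡rp : q ≡ r ℕ.* p
  q≡rp = _∣_.equality p∣q

numerator-equation : ∀ d X w → fromℕ d * X ≡ fromℤ w → (ℤ.+ d ℤ.* ↥ X) ℤ.* ℤ.+ 1 ≡ w ℤ.* ℤ.+ (1 ℕ.* ↧ₙ X)
numerator-equation d X@record{} w dX≡w = ℚᵘP.drop-*≡* (ℚᵘP.≃-trans
  (ℚᵘP.≃-sym (ℚᵘP.≃-trans (ℚP.toℚᵘ-homo-* (fromℕ d) X) (ℚᵘP.*-cong (toℚᵘ-fromℤ (ℤ.+ d)) (ℚᵘP.≃-refl {toℚᵘ X}))))
  (ℚᵘP.≃-trans (ℚᵘP.≃-reflexive (cong toℚᵘ dX≡w)) (toℚᵘ-fromℤ w)))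

IntegralAt : ℕ → ℚ → Set
IntegralAt p x = Σ ℕ λ d → ¬ p ∣ d × Σ ℤ λ z → fromℕ d * x ≡ fromℤ z

module _ {p : ℕ} (p-prime : Prime p) where

  ∤-* : ∀ {a b} → ¬ p ∣ a → ¬ p ∣ b → ¬ p ∣ a ℕ.* b
  ∤-* {a} {b} p∤a p∤b p∣ab = [ p∤a , p∤b ]′ (euclidsLemma a b p-prime p∣ab)

  ∤-1 : ¬ p ∣ 1
  ∤-1 p∣1 = ¬prime[1] (subst Prime (∣1⇒≡1 p∣1) p-prime)

  IntegralAt-fromℤ : ∀ z → IntegralAt p (fromℤ z)
  IntegralAt-fromℤ z = 1 , ∤-1 , z , ℚP.*-identityˡ (fromℤ z)

  IntegralAt-+ : ∀ {x y} → IntegralAt p x → IntegralAt p y → IntegralAt p (x + y)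
  IntegralAt-+ {x} {y} (d₁ , p∤d₁ , z₁ , e₁) (d₂ , p∤d₂ , z₂ , e₂) =
    d₁ ℕ.* d₂ , ∤-* p∤d₁ p∤d₂ , ℤ.+ d₂ ℤ.* z₁ ℤ.+ ℤ.+ d₁ ℤ.* z₂ , (begin
      fromℕ (d₁ ℕ.* d₂) * (x + y)                          ≡⟨ cong (_* (x + y)) (fromℕ-* d₁ d₂) ⟩
      (fromℕ d₁ * fromℕ d₂) * (x + y)                      ≡⟨ distribute (fromℕ d₁) (fromℕ d₂) x y ⟩
      fromℕ d₂ * (fromℕ d₁ * x) + fromℕ d₁ * (fromℕ d₂ * y) ≡⟨ cong₂ (λ a b → fromℕ d₂ * a + fromℕ d₁ * b) e₁ e₂ ⟩
      fromℕ d₂ * fromℤ z₁ + fromℕ d₁ * fromℤ z₂            ≡⟨ cong₂ _+_ (fromℤ-* (ℤ.+ d₂) z₁) (fromℤ-* (ℤ.+ d₁) z₂) ⟨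
      fromℤ (ℤ.+ d₂ ℤ.* z₁) + fromℤ (ℤ.+ d₁ ℤ.* z₂)        ≡⟨ fromℤ-+ (ℤ.+ d₂ ℤ.* z₁) (ℤ.+ d₁ ℤ.* z₂) ⟨
      fromℤ (ℤ.+ d₂ ℤ.* z₁ ℤ.+ ℤ.+ d₁ ℤ.* z₂)              ∎)
    where
    open ≡-Reasoning
    distribute : ∀ a b x y → (a * b) * (x + y) ≡ b * (a * x) + a * (b * y)
    distribute = solve-∀ ℚ-ring

  IntegralAt-* : ∀ {x y} → IntegralAt p x → IntegralAt p y → IntegralAt p (x * y)
  IntegralAt-* {x} {y} (d₁ , p∤d₁ , z₁ , e₁) (d₂ , p∤d₂ , z₂ , e₂) =
    d₁ ℕ.* d₂ , ∤-* p∤d₁ p∤d₂ , z₁ ℤ.* z₂ , (begin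
      fromℕ (d₁ ℕ.* d₂) * (x * y)          ≡⟨ cong (_* (x * y)) (fromℕ-* d₁ d₂) ⟩
      (fromℕ d₁ * fromℕ d₂) * (x * y)      ≡⟨ interchange (fromℕ d₁) (fromℕ d₂) x y ⟩
      (fromℕ d₁ * x) * (fromℕ d₂ * y)      ≡⟨ cong₂ _*_ e₁ e₂ ⟩
      fromℤ z₁ * fromℤ z₂                  ≡⟨ fromℤ-* z₁ z₂ ⟨
      fromℤ (z₁ ℤ.* z₂)                    ∎)
    where
    open ≡-Reasoning
    interchange : ∀ a b x y → (a * b) * (x * y) ≡ (a * x) * (b * y)
    interchange = solve-∀ ℚ-ring

  IntegralAt-neg : ∀ {x} → IntegralAt p x → IntegralAt p (- x)
  IntegralAt-neg {x} (d , p∤d , z , e) =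
    d , p∤d , ℤ.- z , trans (sym (ℚP.neg-distribʳ-* (fromℕ d) x)) (trans (cong -_ e) (sym (fromℤ-neg z)))

  IntegralAt-Σℚ : ∀ {xs} → All (IntegralAt p) xs → IntegralAt p (Σℚ xs)
  IntegralAt-Σℚ []       = IntegralAt-fromℤ (ℤ.+ 0)
  IntegralAt-Σℚ (x ∷ xs) = IntegralAt-+ x (IntegralAt-Σℚ xs)

  IntegralAt-∑ : ∀ a b f → (∀ k → a ≤ k → k ≤ b → IntegralAt p (f k)) → IntegralAt p (∑ a b f)
  IntegralAt-∑ a b f integral = subst (IntegralAt p) (sym (∑-def a b f))
    (IntegralAt-Σℚ (AllP.map⁺ (All.tabulate λ k∈ → let a≤k , k≤b = ∈-interval⁻ k∈ in integral _ a≤k k≤b)))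

  IntegralAt-invPow : ∀ k a → k < p → IntegralAt p (invPow k a)
  IntegralAt-invPow zero    a _   = IntegralAt-fromℤ (ℤ.+ 0)
  IntegralAt-invPow (suc j) a j<p =
    suc j ^ a , ∤-pow a , ℤ.+ 1 , trans (ℚP.*-comm (fromℕ (suc j ^ a)) (invPow (suc j) a)) (invPow-inverse j a)
    where
    ∤-pow : ∀ a → ¬ p ∣ suc j ^ a
    ∤-pow zero    = ∤-1
    ∤-pow (suc a) = ∤-* (λ p∣ → ℕP.<⇒≱ j<p (∣⇒≤ p∣)) (∤-pow a)

  IntegralAt-C± : ∀ n k → IntegralAt p (C± n k)
  IntegralAt-C± n k with C±-integral n k
  ... | z , C≡z = subst (IntegralAt p) (sym C≡z) (IntegralAt-fromℤ z)

  IntegralAt-½ : p ≢ 2 → IntegralAt p ½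
  IntegralAt-½ p≢2 = 2 , ∤-2 , ℤ.+ 1 , refl
    where
    ∤-2 : ¬ p ∣ 2
    ∤-2 p∣2 with ∣⇒≤ p∣2
    ... | s≤s z≤n       = ¬prime[1] p-prime
    ... | s≤s (s≤s z≤n) = p≢2 refl

  IntegralAt-Sʳ : ∀ R k → k < p → IntegralAt p (Sʳ R k)
  IntegralAt-Sʳ []      k _   = IntegralAt-fromℤ (ℤ.+ 1)
  IntegralAt-Sʳ (a ∷ R) k k<p = IntegralAt-∑ 1 k _ λ j _ j≤k →
    IntegralAt-* (IntegralAt-invPow j a (ℕP.≤-<-trans j≤k k<p)) (IntegralAt-Sʳ R j (ℕP.≤-<-trans j≤k k<p))

  IntegralAt-Sʳ-top : ∀ R k → k < p → IntegralAt p (Sʳ-top R k)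
  IntegralAt-Sʳ-top []      k _   = IntegralAt-fromℤ (ℤ.+ 0)
  IntegralAt-Sʳ-top (a ∷ R) k k<p = IntegralAt-* (IntegralAt-invPow k a k<p) (IntegralAt-Sʳ R k k<p)

  IntegralAt-binomialRemainder : ∀ N k → k < p → IntegralAt p (binomialRemainder N k)
  IntegralAt-binomialRemainder N k k<p = IntegralAt-∑ 1 k _ λ i _ i≤k →
    let i<p = ℕP.≤-<-trans i≤k k<p in
    IntegralAt-* (IntegralAt-* (IntegralAt-invPow i 1 i<p) (IntegralAt-invPow i 1 i<p)) (IntegralAt-C± N (i ∸ 1))

  IntegralAt-harmonicQuotient : p ≢ 2 → ∀ N → N < p → IntegralAt p (harmonicQuotient N)
  IntegralAt-harmonicQuotient p≢2 N N<p = IntegralAt-* (IntegralAt-½ p≢2) (IntegralAt-∑ 1 N _ λ j 1≤j j≤N →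
    IntegralAt-* (IntegralAt-invPow j 1 (ℕP.≤-<-trans j≤N N<p))
                 (IntegralAt-invPow (suc N ∸ j) 1 (ℕP.≤-<-trans (ℕP.∸-monoʳ-≤ (suc N) 1≤j) N<p)))

  p²∣numerator : ∀ X Y → X ≡ fromℕ p * fromℕ p * Y → IntegralAt p Y → (ℤ.+ (p ^ 2)) ∣ℤ ↥ X
  p²∣numerator X Y X≡ppY (d , p∤d , z , dY≡z) = prime²-∣ p-prime d ℤ.∣ ↥ X ∣ (ℤ.∣ z ∣ ℕ.* ↧ₙ X) p∤d (begin
    d ℕ.* ℤ.∣ ↥ X ∣                                ≡⟨ ℤP.abs-* (ℤ.+ d) (↥ X) ⟨
    ℤ.∣ ℤ.+ d ℤ.* ↥ X ∣                            ≡⟨ cong ℤ.∣_∣ (ℤP.*-identityʳ (ℤ.+ d ℤ.* ↥ X)) ⟨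
    ℤ.∣ (ℤ.+ d ℤ.* ↥ X) ℤ.* ℤ.+ 1 ∣                ≡⟨ cong ℤ.∣_∣ (numerator-equation d X w dX≡w) ⟩
    ℤ.∣ w ℤ.* ℤ.+ (1 ℕ.* ↧ₙ X) ∣                    ≡⟨ ℤP.abs-* w _ ⟩
    ℤ.∣ w ∣ ℕ.* (1 ℕ.* ↧ₙ X)
      ≡⟨ cong₂ ℕ._*_ (trans (ℤP.abs-* (ℤ.+ p) _) (cong (p ℕ.*_) (ℤP.abs-* (ℤ.+ p) z))) (ℕP.*-identityˡ (↧ₙ X)) ⟩
    p ℕ.* (p ℕ.* ℤ.∣ z ∣) ℕ.* ↧ₙ X                   ≡⟨ reassociate p ℤ.∣ z ∣ (↧ₙ X) ⟩
    p ℕ.* (p ℕ.* (ℤ.∣ z ∣ ℕ.* ↧ₙ X))                 ∎)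
    where
    open ≡-Reasoning
    w : ℤ
    w = ℤ.+ p ℤ.* (ℤ.+ p ℤ.* z)
    reassociate : ∀ p z D → p ℕ.* (p ℕ.* z) ℕ.* D ≡ p ℕ.* (p ℕ.* (z ℕ.* D))
    reassociate = ℕSolver.solve-∀
    rearrange : ∀ d p y → d * (p * p * y) ≡ p * p * (d * y)
    rearrange = solve-∀ ℚ-ring
    dX≡w : fromℕ d * X ≡ fromℤ w
    dX≡w = begin
      fromℕ d * X                                  ≡⟨ cong (fromℕ d *_) X≡ppY ⟩
      fromℕ d * (fromℕ p * fromℕ p * Y)            ≡⟨ rearrange (fromℕ d) (fromℕ p) Y ⟩
      fromℕ p * fromℕ p * (fromℕ d * Y)            ≡⟨ cong (fromℕ p * fromℕ p *_) dY≡z ⟩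
      fromℕ p * fromℕ p * fromℤ z                  ≡⟨ ℚP.*-assoc (fromℕ p) (fromℕ p) (fromℤ z) ⟩
      fromℕ p * (fromℕ p * fromℤ z)                ≡⟨ cong (fromℕ p *_) (fromℤ-* (ℤ.+ p) z) ⟨
      fromℕ p * fromℤ (ℤ.+ p ℤ.* z)                ≡⟨ fromℤ-* (ℤ.+ p) (ℤ.+ p ℤ.* z) ⟨
      fromℤ w                                      ∎

theorem2p11 : (s : Composite) → s ≢ [] → All (λ a → 1 ≤ a) s →
    (p : ℕ) → Prime p → p ≢ 2 →
    (ℚ.- S (dual s) (p ∸ 1))
      ≡ S s (p ∸ 1)
        ℚ.+ (ℤ.+ p ℚ./ 1) ℚ.* Σℚ (map (λ t → H (append1 t) (p ∸ 1)) (coarsenings s))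
      [modℚ p ^ 2 ]
theorem2p11 []        s≢[] _   _       _       _   = ⊥-elim (s≢[] refl)
theorem2p11 (a₀ ∷ s₀) _    _   zero    p-prime _   = ⊥-elim (¬prime[0] p-prime)
theorem2p11 (a₀ ∷ s₀) _    pos (suc N) p-prime p≢2 with reverse-positive a₀ s₀ pos
... | a , R , rev≡ , posR = p²∣numerator p-prime _ Y difference≡ Y-integral
  where
  s : Composite
  s = a₀ ∷ s₀
  φ : ℕ → ℚ
  φ = S*-top s
  Y : ℚ
  Y = ∑[ k ∈ 1 ⋯ N ] (φ k * (harmonicQuotient N - binomialRemainder N k))
  S≡ : ∀ n → S s n ≡ - binomialTransform φ n
  S≡ = S-hoffman s a R rev≡ posR
  difference≡ : (- S (dual s) N) - (S s N + fromℕ (suc N) * Σℚ (map (λ t → H (append1 t) N) (coarsenings s)))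
                  ≡ fromℕ (suc N) * fromℕ (suc N) * Y
  difference≡ = trans (cong₂ (λ x y → (- x) - y) (S-dual s a R rev≡ N)
                        (cong₂ (λ x y → x + fromℕ (suc N) * y) (S≡ N) (coarsenings-H a₀ s₀ N φ S≡)))
                      (congruence-combination N φ)
  Y-integral : IntegralAt (suc N) Y
  Y-integral = IntegralAt-∑ p-prime 1 N _ λ k _ k≤N →
    IntegralAt-* p-prime (IntegralAt-Sʳ-top p-prime (reverse (dual s)) k (s≤s k≤N))
      (IntegralAt-+ p-prime (IntegralAt-harmonicQuotient p-prime p≢2 N ℕP.≤-refl)
                            (IntegralAt-neg p-prime (IntegralAt-binomialRemainder p-prime N k (s≤s k≤N))))
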